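{- Let $n\ge 2$ and let $SD_{8n}=\langle a,b : a^{4n}=e,\ b^2=e,\ ba=a^{2n-1}b\rangle$ be the semidihedral group of order $8n$. (i) If $n$ is even, then $CSEP(SD_{8n})\cong H[\Gamma_1,\dots,\Gamma_{2n+3}]$, where $H=K_1\vee\big((K_1\vee(K_{2n-1}\cup K_1))\cup K_1\big)$, with vertex $1$ the outermost $K_1$, vertex $2$ the $K_1$ joined to $K_{2n-1}\cup K_1$, vertices $3,\dots,2n+1$ the vertices of $K_{2n-1}$, vertex $2n+2$ the $K_1$ in $K_{2n-1}\cup K_1$, and vertex $2n+3$ the last $K_1$; and $\Gamma_1=\Gamma_2=K_1$, $\Gamma_i=K_2$ for $3\le i\le 2n+1$, $\Gamma_{2n+2}=\Gamma_{2n+3}=K_{2n}$. (ii) If $n$ is odd, then $CSEP(SD_{8n})\cong H[\Gamma_1,\dots,\Gamma_{2n+4}]$, where $H=K_1\vee\big((K_1\vee(K_{2n-1}\cup K_1))\cup K_1\cup K_1\big)$, with vertices $1,\dots,2n+2$ as in (i) and vertices $2n+3,2n+4$ the last two $K_1$'s; and $\Gamma_1=\Gamma_2=K_1$, $\Gamma_i=K_2$ for $3\le i\le 2n+1$, $\Gamma_{2n+2}=K_{2n}$, $\Gamma_{2n+3}=\Gamma_{2n+4}=K_n$.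
   Context: For a finite group $G$ and $x\in G$, $[x]$ denotes the conjugacy class of $x$. The conjugacy superenhanced power graph $CSEP(G)$ is the simple graph with vertex set $G$ in which two distinct vertices $x,y$ are adjacent iff there exist $x'\in[x]$, $y'\in[y]$ lying in a common cyclic subgroup of $G$ ($x'=y'$ permitted, so distinct conjugate elements are always adjacent). $K_m$ is the complete graph on $m$ vertices; $\cup$ is disjoint union and $\vee$ is join (disjoint union plus all edges between the two parts). For a graph $H$ on $\{1,\dots,k\}$ and graphs $\Gamma_1,\dots,\Gamma_k$, the generalized composition $H[\Gamma_1,\dots,\Gamma_k]$ has vertex set the disjoint union of the $V(\Gamma_i)$, with $u\in V(\Gamma_i)$, $v\in V(\Gamma_j)$ adjacent iff either $i=j$ and $u\sim v$ in $\Gamma_i$, or $i\neq j$ and $i\sim j$ in $H$. -}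

module Defs where

open import Level using (0ℓ)
open import Data.Nat using (ℕ; zero; suc; _+_; _*_; _∸_; NonZero)
open import Data.Nat.Properties using (m*n≢0)
open import Data.Nat.DivMod using (_mod_)
open import Data.Nat.Divisibility using (_∣_)
open import Data.Fin using (Fin; toℕ)
open import Data.Bool using (Bool; true; false; not)
open import Data.Product using (Σ; ∃; ∃-syntax; _×_; _,_)
open import Data.Sum using (_⊎_; inj₁; inj₂)
open import Data.Unit using (⊤; tt)
open import Data.Empty using (⊥)
open import Relation.Nullary using (¬_)
open import Relation.Binary.PropositionalEquality using (_≡_; _≢_; subst)
open import Function.Bundles using (_⤖_; _⇔_; Bijection)

Even : ℕ → Set
Even n = 2 ∣ n

Odd : ℕ → Set
Odd n = ¬ (2 ∣ n)

-- Simple graphs: a vertex type with an (irreflexive, symmetric) adjacency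
-- relation.  All graphs built below are simple by construction.

record Graph : Set₁ where
  field
    V   : Set
    Adj : V → V → Set
open Graph public

record _≅_ (Γ Δ : Graph) : Set where
  field
    bij  : V Γ ⤖ V Δ
    pres : ∀ x y → Adj Γ x y ⇔ Adj Δ (Bijection.to bij x) (Bijection.to bij y)

K : ℕ → Graph
K m = record { V = Fin m ; Adj = λ x y → x ≢ y }

_∪ᴳ_ : Graph → Graph → Graph
Γ ∪ᴳ Δ = record { V = V Γ ⊎ V Δ ; Adj = adj }
  where
  adj : V Γ ⊎ V Δ → V Γ ⊎ V Δ → Set
  adj (inj₁ x) (inj₁ y) = Adj Γ x y
  adj (inj₂ x) (inj₂ y) = Adj Δ x y
  adj _        _        = ⊥

_∨ᴳ_ : Graph → Graph → Graph
Γ ∨ᴳ Δ = record { V = V Γ ⊎ V Δ ; Adj = adj }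
  where
  adj : V Γ ⊎ V Δ → V Γ ⊎ V Δ → Set
  adj (inj₁ x) (inj₁ y) = Adj Γ x y
  adj (inj₂ x) (inj₂ y) = Adj Δ x y
  adj _        _        = ⊤

infixr 5 _∪ᴳ_
infixr 4 _∨ᴳ_

composition : (H : Graph) → (V H → Graph) → Graph
composition H Γ = record { V = Σ (V H) (λ i → V (Γ i)) ; Adj = adj }
  where
  adj : Σ (V H) (λ i → V (Γ i)) → Σ (V H) (λ i → V (Γ i)) → Set
  adj (i , u) (j , v) =
    (Σ (i ≡ j) λ p → Adj (Γ j) (subst (λ k → V (Γ k)) p u) v)
    ⊎ (i ≢ j × Adj H i j)

-- Element (i , false) stands for a^i, (i , true) for a^i b, with i mod 4n.
-- Multiplication uses  b a^k = a^{(2n-1)k} b.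

module SD (n : ℕ) .{{_ : NonZero n}} where
  private instance
    nz4n : NonZero (4 * n)
    nz4n = m*n≢0 4 n

  El : Set
  El = Fin (4 * n) × Bool

  e : El
  e = (0 mod (4 * n)) , false

  _·_ : El → El → El
  (i , false) · (k , l) = ((toℕ i + toℕ k) mod (4 * n)) , l
  (i , true)  · (k , l) = ((toℕ i + (2 * n ∸ 1) * toℕ k) mod (4 * n)) , not l

  pow : El → ℕ → El
  pow x zero    = e
  pow x (suc k) = x · pow x k

  -- y ∈ [x] : y = g x g⁻¹ for some g (h is the inverse of g)
  Conj : El → El → Set
  Conj x y = ∃[ g ] ∃[ h ] (g · h ≡ e × y ≡ (g · x) · h)

  InCommonCyclic : El → El → Set
  InCommonCyclic x y = ∃[ z ] ((∃[ k ] pow z k ≡ x) × (∃[ m ] pow z m ≡ y))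

  CSEP : Graph
  CSEP = record
    { V   = El
    ; Adj = λ x y → x ≢ y × (∃[ x' ] ∃[ y' ] (Conj x x' × Conj y y' × InCommonCyclic x' y'))
    }

Heven : ℕ → Graph
Heven n = K 1 ∨ᴳ ((K 1 ∨ᴳ (K (2 * n ∸ 1) ∪ᴳ K 1)) ∪ᴳ K 1)

Γeven : (n : ℕ) → V (Heven n) → Graph
Γeven n (inj₁ _)                             = K 1      -- vertex 1
Γeven n (inj₂ (inj₁ (inj₁ _)))               = K 1      -- vertex 2
Γeven n (inj₂ (inj₁ (inj₂ (inj₁ _))))        = K 2      -- vertices 3..2n+1
Γeven n (inj₂ (inj₁ (inj₂ (inj₂ _))))        = K (2 * n) -- vertex 2n+2
Γeven n (inj₂ (inj₂ _))                      = K (2 * n) -- vertex 2n+3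

Hodd : ℕ → Graph
Hodd n = K 1 ∨ᴳ ((K 1 ∨ᴳ (K (2 * n ∸ 1) ∪ᴳ K 1)) ∪ᴳ K 1 ∪ᴳ K 1)

Γodd : (n : ℕ) → V (Hodd n) → Graph
Γodd n (inj₁ _)                              = K 1      -- vertex 1
Γodd n (inj₂ (inj₁ (inj₁ _)))                = K 1      -- vertex 2
Γodd n (inj₂ (inj₁ (inj₂ (inj₁ _))))         = K 2      -- vertices 3..2n+1
Γodd n (inj₂ (inj₁ (inj₂ (inj₂ _))))         = K (2 * n) -- vertex 2n+2
Γodd n (inj₂ (inj₂ (inj₁ _)))                = K n      -- vertex 2n+3
Γodd n (inj₂ (inj₂ (inj₂ _)))                = K n      -- vertex 2n+4

module Submission where

-- Each element of SD_{8n} is a^i or a^i b, and we sort them into kinds: e; the central involution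
-- a^{2n}; the other a^i; the a^i b with i odd, of order 4 with square a^{2n}; and the involutions a^i b
-- with i even, split by i mod 4 when n is odd (this is where the two cases of the theorem differ).
-- Conjugation preserves the kind, and the powers of any one element have pairwise linked kinds in the
-- pattern graph where e is linked to everything, a^{2n} to the other a^i and to the a^i b with i odd,
-- and each kind to itself; conversely every link is witnessed by an explicit conjugate lying in an
-- explicit cyclic subgroup. Hence two distinct elements are adjacent in CSEP(SD_{8n}) exactly when their
-- kinds are linked. The composition H[Γ_1, ...] has the same description for the evident labelling of H
-- by kinds, and the blocks have the sizes of the kinds, so a kind-preserving bijection is an isomorphism.

open import Defs
open import Data.Nat
open import Data.Nat.Properties
open import Data.Nat.DivMod
open import Data.Nat.Tactic.RingSolver using (solve-∀)
open import Data.Nat.Divisibility using (_∣_; divides; m%n≡0⇒n∣m)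
open import Data.Fin using (Fin; toℕ; fromℕ<) renaming (zero to fz; suc to fs)
open import Data.Fin.Properties using (toℕ-fromℕ<; toℕ-injective; toℕ<n) renaming (_≟_ to _≟ᶠ_)
open import Data.Bool using (Bool; true; false; T; _∨_)
open import Data.Bool.Properties using (∨-comm; ∨-zeroʳ)
open import Data.Product using (Σ; ∃; ∃-syntax; _×_; _,_; proj₁; proj₂)
open import Data.Sum using (_⊎_; inj₁; inj₂; [_,_])
open import Data.Sum.Properties using (inj₁-injective; inj₂-injective; ≡-dec)
open import Data.Unit using (tt)
open import Data.Empty using (⊥-elim)
open import Function using (_∘_; id)
open import Function.Bundles using (_⇔_; _↔_; mk⇔; mk↔ₛ′; Equivalence; Inverse; Injection)
open import Function.Properties.Inverse using (↔⇒⤖; ↔⇒↣; ↔-trans)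
open import Relation.Binary.Definitions using (DecidableEquality)
open import Relation.Binary.PropositionalEquality
  using (_≡_; _≢_; refl; sym; trans; cong; cong₂; subst; subst₂; module ≡-Reasoning)
open import Relation.Nullary using (¬_; Dec; yes; no)

-- Graphs whose adjacency is read off vertex labels

module Labelled {L : Set} (R : L → L → Set) where

  AdjacencyVia : (Γ : Graph) → (V Γ → L) → Set
  AdjacencyVia Γ c = ∀ x y → Adj Γ x y ⇔ (x ≢ y × R (c x) (c y))

  private
    ≢-along-injection : ∀ {A B P S : Set} {x y : A} (ι : A → B) →
      (∀ {x y} → ι x ≡ ι y → x ≡ y) → P ⇔ (x ≢ y × S) → P ⇔ (ι x ≢ ι y × S)
    ≢-along-injection ι ι-inj P⇔ = mk⇔
      (λ a → let ne , s = Equivalence.to P⇔ a in ne ∘ ι-inj , s)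
      (λ (ne , s) → Equivalence.from P⇔ (ne ∘ cong ι , s))

  K-adjacencyVia : ∀ {m} l → R l l → AdjacencyVia (K m) (λ _ → l)
  K-adjacencyVia l r x y = mk⇔ (_, r) proj₁

  ∨-adjacencyVia : ∀ {Γ Δ c d} → AdjacencyVia Γ c → AdjacencyVia Δ d →
    (∀ x y → R (c x) (d y)) → (∀ x y → R (d y) (c x)) →
    AdjacencyVia (Γ ∨ᴳ Δ) [ c , d ]
  ∨-adjacencyVia Γc Δd cd dc (inj₁ x) (inj₁ y) = ≢-along-injection inj₁ inj₁-injective (Γc x y)
  ∨-adjacencyVia Γc Δd cd dc (inj₂ x) (inj₂ y) = ≢-along-injection inj₂ inj₂-injective (Δd x y)
  ∨-adjacencyVia Γc Δd cd dc (inj₁ x) (inj₂ y) = mk⇔ (λ _ → (λ ()) , cd x y) (λ _ → tt)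
  ∨-adjacencyVia Γc Δd cd dc (inj₂ x) (inj₁ y) = mk⇔ (λ _ → (λ ()) , dc y x) (λ _ → tt)

  ∪-adjacencyVia : ∀ {Γ Δ c d} → AdjacencyVia Γ c → AdjacencyVia Δ d →
    (∀ x y → ¬ R (c x) (d y)) → (∀ x y → ¬ R (d y) (c x)) →
    AdjacencyVia (Γ ∪ᴳ Δ) [ c , d ]
  ∪-adjacencyVia Γc Δd cd dc (inj₁ x) (inj₁ y) = ≢-along-injection inj₁ inj₁-injective (Γc x y)
  ∪-adjacencyVia Γc Δd cd dc (inj₂ x) (inj₂ y) = ≢-along-injection inj₂ inj₂-injective (Δd x y)
  ∪-adjacencyVia Γc Δd cd dc (inj₁ x) (inj₂ y) = mk⇔ (λ ()) (λ (_ , r) → cd x y r)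
  ∪-adjacencyVia Γc Δd cd dc (inj₂ x) (inj₁ y) = mk⇔ (λ ()) (λ (_ , r) → dc y x r)

  composition-adjacencyVia : ∀ {H : Graph} {Γ : V H → Graph} {c : V H → L} →
    DecidableEquality (V H) → (∀ l → R l l) → (∀ i u v → Adj (Γ i) u v ⇔ (u ≢ v)) →
    AdjacencyVia H c → AdjacencyVia (composition H Γ) (c ∘ proj₁)
  composition-adjacencyVia {H} {Γ} {c} _≟_ R-refl Γ-complete Hc (i , u) (j , v) = mk⇔ to from
    where
    to : Adj (composition H Γ) (i , u) (j , v) → ((i , u) ≢ (j , v) × R (c i) (c j))
    to (inj₁ (refl , a)) = (λ { refl → Equivalence.to (Γ-complete i u u) a refl }) , R-refl (c i)
    to (inj₂ (ne , h)) = (ne ∘ cong proj₁) , proj₂ (Equivalence.to (Hc i j) h)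
    from : ((i , u) ≢ (j , v) × R (c i) (c j)) → Adj (composition H Γ) (i , u) (j , v)
    from (ne , r) with i ≟ j
    ... | yes refl = inj₁ (refl , Equivalence.from (Γ-complete i u v) (ne ∘ cong (i ,_)))
    ... | no i≢j = inj₂ (i≢j , Equivalence.from (Hc i j) (i≢j , r))

  ≅-via : ∀ {Γ Δ c d} → AdjacencyVia Γ c → AdjacencyVia Δ d →
    (f : V Γ ↔ V Δ) → (∀ x → d (Inverse.to f x) ≡ c x) → Γ ≅ Δ
  ≅-via {Γ} {Δ} {c} {d} Γc Δd f d∘f≡c = record
    { bij  = ↔⇒⤖ f
    ; pres = λ x y → mk⇔
        (λ a → Equivalence.from (Δd _ _) (relabel (Equivalence.to (via x y) a)))
        (λ a → Equivalence.from (via x y) (unlabel (Equivalence.to (Δd _ _) a)))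
    }
    where
    open Inverse f using (to)
    via : ∀ x y → Adj Γ x y ⇔ (to x ≢ to y × R (c x) (c y))
    via x y = ≢-along-injection to (Injection.injective (↔⇒↣ f)) (Γc x y)
    relabel : ∀ {x y} → (to x ≢ to y × R (c x) (c y)) → (to x ≢ to y × R (d (to x)) (d (to y)))
    relabel {x} {y} (ne , r) = ne , subst₂ R (sym (d∘f≡c x)) (sym (d∘f≡c y)) r
    unlabel : ∀ {x y} → (to x ≢ to y × R (d (to x)) (d (to y))) → (to x ≢ to y × R (c x) (c y))
    unlabel {x} {y} (ne , r) = ne , subst₂ R (d∘f≡c x) (d∘f≡c y) r

module Congruence (d : ℕ) .{{_ : NonZero d}} where
  infix 4 _≋_
  -- A record rather than a % d ≡ b % d, so that a and b can be inferred from it.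
  record _≋_ (a b : ℕ) : Set where
    constructor mk≋
    field %-≡ : a % d ≡ b % d
  open _≋_ public

  ≋-refl : ∀ {a} → a ≋ a
  ≋-refl = mk≋ refl

  ≋-sym : ∀ {a b} → a ≋ b → b ≋ a
  ≋-sym (mk≋ e) = mk≋ (sym e)

  infixr 5 _⨾_
  _⨾_ : ∀ {a b c} → a ≋ b → b ≋ c → a ≋ c
  mk≋ e₁ ⨾ mk≋ e₂ = mk≋ (trans e₁ e₂)

  ≡⇒≋ : ∀ {a b} → a ≡ b → a ≋ b
  ≡⇒≋ refl = ≋-refl

  m%d≋m : ∀ m → m % d ≋ m
  m%d≋m m = mk≋ (m%n%n≡m%n m d)

  m+k*d≋m : ∀ m k → m + k * d ≋ m
  m+k*d≋m m k = mk≋ ([m+kn]%n≡m%n m k d)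

  m+k*d≡n+l*d⇒m≋n : ∀ {m n} k l → m + k * d ≡ n + l * d → m ≋ n
  m+k*d≡n+l*d⇒m≋n {m} {n} k l eq = ≋-sym (m+k*d≋m m k) ⨾ ≡⇒≋ eq ⨾ m+k*d≋m n l

  +≋+ : ∀ {a a′ b b′} → a ≋ a′ → b ≋ b′ → a + b ≋ a′ + b′
  +≋+ {a} {a′} {b} {b′} (mk≋ e₁) (mk≋ e₂) = mk≋ (begin
    (a + b) % d             ≡⟨ %-distribˡ-+ a b d ⟩
    (a % d + b % d) % d     ≡⟨ cong₂ (λ x y → (x + y) % d) e₁ e₂ ⟩
    (a′ % d + b′ % d) % d   ≡⟨ %-distribˡ-+ a′ b′ d ⟨
    (a′ + b′) % d           ∎)
    where open ≡-Reasoning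

  *≋* : ∀ {a a′ b b′} → a ≋ a′ → b ≋ b′ → a * b ≋ a′ * b′
  *≋* {a} {a′} {b} {b′} (mk≋ e₁) (mk≋ e₂) = mk≋ (begin
    (a * b) % d               ≡⟨ %-distribˡ-* a b d ⟩
    (a % d * (b % d)) % d     ≡⟨ cong₂ (λ x y → (x * y) % d) e₁ e₂ ⟩
    (a′ % d * (b′ % d)) % d   ≡⟨ %-distribˡ-* a′ b′ d ⟨
    (a′ * b′) % d             ∎)
    where open ≡-Reasoning

  +≋+ˡ : ∀ {a b} c → a ≋ b → c + a ≋ c + b
  +≋+ˡ c = +≋+ (≋-refl {c})

  +≋+ʳ : ∀ {a b} c → a ≋ b → a + c ≋ b + c
  +≋+ʳ c e = +≋+ e (≋-refl {c})

  *≋*ˡ : ∀ {a b} c → a ≋ b → c * a ≋ c * b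
  *≋*ˡ c = *≋* (≋-refl {c})

  <∧≋⇒≡% : ∀ {a b} → a < d → a ≋ b → a ≡ b % d
  <∧≋⇒≡% a<d (mk≋ e) = trans (sym (m<n⇒m%n≡m a<d)) e

  <∧<∧≋⇒≡ : ∀ {a b} → a < d → b < d → a ≋ b → a ≡ b
  <∧<∧≋⇒≡ a<d b<d a≋b = trans (<∧≋⇒≡% a<d a≋b) (m<n⇒m%n≡m b<d)

  ∣∧≋⇒%≡ : ∀ {a b} k .{{_ : NonZero k}} → k ∣ d → a ≋ b → a % k ≡ b % k
  ∣∧≋⇒%≡ {a} {b} k k∣d (mk≋ e) =
    trans (sym (m∣n⇒o%n%m≡o%m k d a k∣d)) (trans (cong (_% k) e) (m∣n⇒o%n%m≡o%m k d b k∣d))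

module Semidihedral (p : ℕ) where
  n : ℕ
  n = suc p

  N : ℕ
  N = 4 * n

  instance
    N-nonZero : NonZero N
    N-nonZero = record { nonZero = tt }

  open SD n public
  open Congruence N public

  M : ℕ
  M = 2 * n ∸ 1

  N≡2n+2n : N ≡ 2 * n + 2 * n
  N≡2n+2n = expand p
    where
    expand : ∀ p → 4 * suc p ≡ 2 * suc p + 2 * suc p
    expand = solve-∀

  N≡2n*2 : N ≡ 2 * n * 2
  N≡2n*2 = expand p
    where
    expand : ∀ p → 4 * suc p ≡ 2 * suc p * 2
    expand = solve-∀

  2∣N : 2 ∣ N
  2∣N = divides (2 * n) N≡2n*2

  4∣N : 4 ∣ N
  4∣N = divides n (*-comm 4 n)

  2n<N : 2 * n < N
  2n<N = subst (2 * n <_) (sym N≡2n+2n) (m<m+n (2 * n) (s≤s z≤n))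

  M≡1+2p : M ≡ suc (2 * p)
  M≡1+2p = +-suc p (p + 0)

  substM : (P : ℕ → Set) → P (suc (2 * p)) → P M
  substM P = subst P (sym M≡1+2p)

  exp : El → ℕ
  exp = toℕ ∘ proj₁

  exp<N : ∀ x → exp x < N
  exp<N (i , _) = toℕ<n i

  -- exp (x · a^k) = exp x + twist x k, by the rule b a^k = a^{M k} b.
  twist : El → ℕ → ℕ
  twist (_ , false) k = k
  twist (_ , true)  k = M * k

  exp-· : ∀ x y → exp (x · y) ≡ (exp x + twist x (exp y)) % N
  exp-· (i , false) (k , _) = toℕ-fromℕ< (m%n<n (toℕ i + toℕ k) N)
  exp-· (i , true)  (k , _) = toℕ-fromℕ< (m%n<n (toℕ i + M * toℕ k) N)

  exp-·-≋ : ∀ x y → exp (x · y) ≋ exp x + twist x (exp y)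
  exp-·-≋ x y = ≡⇒≋ (exp-· x y) ⨾ m%d≋m (exp x + twist x (exp y))

  El-ext : ∀ {x : El} {j : Fin N} {b : Bool} → exp x ≡ toℕ j → proj₂ x ≡ b → x ≡ (j , b)
  El-ext {i , _} e refl = cong (_, _) (toℕ-injective e)

  El-ext-≋ : ∀ {x y : El} → exp x ≋ exp y → proj₂ x ≡ proj₂ y → x ≡ y
  El-ext-≋ {x} {j , _} e = El-ext (<∧<∧≋⇒≡ (exp<N x) (toℕ<n j) e)

  ·-identityʳ : ∀ x → x · e ≡ x
  ·-identityʳ x@(i , false) = El-ext-≋ {x · e} {x} (exp-·-≋ x e ⨾ ≡⇒≋ (+-identityʳ (toℕ i))) refl
  ·-identityʳ x@(i , true)  = El-ext-≋ {x · e} {x} (exp-·-≋ x e ⨾ ≡⇒≋ M*0-vanishes) refl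
    where
    M*0-vanishes : toℕ i + M * 0 ≡ toℕ i
    M*0-vanishes = trans (cong (toℕ i +_) (*-zeroʳ M)) (+-identityʳ (toℕ i))

  ·-identityˡ : ∀ x → e · x ≡ x
  ·-identityˡ x = El-ext-≋ {e · x} {x} (exp-·-≋ e x) refl

%2≡0⊎%2≡1 : ∀ m → m % 2 ≡ 0 ⊎ m % 2 ≡ 1
%2≡0⊎%2≡1 m with m % 2 | m%n<n m 2
... | 0           | _               = inj₁ refl
... | 1           | _               = inj₂ refl
... | suc (suc _) | s≤s (s≤s ())

m%4%2≡m%2 : ∀ m → m % 4 % 2 ≡ m % 2
m%4%2≡m%2 m = m∣n⇒o%n%m≡o%m 2 4 m (divides 2 refl)

m%4%2⇒m%2 : ∀ m {r} → m % 4 % 2 ≡ r → m % 2 ≡ r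
m%4%2⇒m%2 m = trans (sym (m%4%2≡m%2 m))

[s*2]%4≡[s%2]*2 : ∀ s → (s * 2) % 4 ≡ (s % 2) * 2
[s*2]%4≡[s%2]*2 s = begin
  (s * 2) % 4                     ≡⟨ cong (λ x → (x * 2) % 4) (m≡m%n+[m/n]*n s 2) ⟩
  ((s % 2 + (s / 2) * 2) * 2) % 4 ≡⟨ cong (_% 4) (distrib (s % 2) (s / 2)) ⟩
  ((s % 2) * 2 + (s / 2) * 4) % 4 ≡⟨ [m+kn]%n≡m%n ((s % 2) * 2) (s / 2) 4 ⟩
  ((s % 2) * 2) % 4               ≡⟨ m<n⇒m%n≡m (*2<4 (m%n<n s 2)) ⟩
  (s % 2) * 2                     ∎
  where
  open ≡-Reasoning
  distrib : ∀ a b → (a + b * 2) * 2 ≡ a * 2 + b * 4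
  distrib = solve-∀
  *2<4 : ∀ {a} → a < 2 → a * 2 < 4
  *2<4 {0} _ = s≤s z≤n
  *2<4 {1} _ = s≤s (s≤s (s≤s z≤n))
  *2<4 {suc (suc _)} (s≤s (s≤s ()))

[1+2a]%2≡1 : ∀ a → suc (2 * a) % 2 ≡ 1
[1+2a]%2≡1 a = trans (cong (_% 2) (1+2a≡1+a*2 a)) ([m+kn]%n≡m%n 1 a 2)
  where
  1+2a≡1+a*2 : ∀ a → suc (2 * a) ≡ 1 + a * 2
  1+2a≡1+a*2 = solve-∀

[2b]%2≡0 : ∀ b → (2 * b) % 2 ≡ 0
[2b]%2≡0 b = trans (cong (_% 2) (*-comm 2 b)) (m*n%n≡0 b 2)

1+2a≢2b : ∀ a b → suc (2 * a) ≢ 2 * b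
1+2a≢2b a b eq with trans (sym ([1+2a]%2≡1 a)) (trans (cong (_% 2) eq) ([2b]%2≡0 b))
... | ()

[4a]%4≡0 : ∀ a → (4 * a) % 4 ≡ 0
[4a]%4≡0 a = trans (cong (_% 4) (*-comm 4 a)) (m*n%n≡0 a 4)
[2+4a]%4≡2 : ∀ a → (2 + 4 * a) % 4 ≡ 2
[2+4a]%4≡2 a = trans (cong (λ x → (2 + x) % 4) (*-comm 4 a)) ([m+kn]%n≡m%n 2 a 4)

4a≢2+4b : ∀ a b → 4 * a ≢ 2 + 4 * b
4a≢2+4b a b eq with trans (sym ([4a]%4≡0 a)) (trans (cong (_% 4) eq) ([2+4a]%4≡2 b))
... | ()

-- The exponent of a^κ · a^{2t} b · a^{-κ} for κ = (s - t)(1 + n), where n = 1 + p and -t is (3 + 4p)t.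
conjExponent : ℕ → ℕ → ℕ → ℕ
conjExponent p s t = (s + (3 + 4 * p) * t) * (1 + suc p) + (0 + t * 2) +
                     suc (2 * p) * ((3 + 4 * p) * ((s + (3 + 4 * p) * t) * (1 + suc p)))

ConjShift : ℕ → ℕ → ℕ → Set
ConjShift p s t = ∃ λ Q → conjExponent p s t ≡ (0 + s * 2) + Q * (4 * suc p)

conjShift-even : ∀ r s t → ConjShift (suc (2 * r)) s t
conjShift-even r s t = 17 * r * s + 183 * r * t + 8 * r * r * s + 192 * r * r * t + 64 * r * r * r * t + 8 * s + 58 * t ,
                       expand r s t
  where
  expand : ∀ r s t →
    (s + (3 + 4 * suc (2 * r)) * t) * (1 + suc (suc (2 * r))) + (0 + t * 2) +
    suc (2 * suc (2 * r)) * ((3 + 4 * suc (2 * r)) * ((s + (3 + 4 * suc (2 * r)) * t) * (1 + suc (suc (2 * r))))) ≡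
    (0 + s * 2) + (17 * r * s + 183 * r * t + 8 * r * r * s + 192 * r * r * t + 64 * r * r * r * t + 8 * s + 58 * t) *
                  (4 * suc (suc (2 * r)))
  expand = solve-∀

conjShift-odd : ∀ q b u v → ConjShift (2 * q) (b + u * 2) (b + v * 2)
conjShift-odd q b u v =
  8 * b + 48 * b * q + 104 * b * q * q + 64 * b * q * q * q + 18 * q * u + 78 * q * v +
  16 * q * q * u + 192 * q * q * v + 128 * q * q * q * v + 3 * u + 13 * v , expand q b u v
  where
  expand : ∀ q b u v →
    ((b + u * 2) + (3 + 4 * (2 * q)) * (b + v * 2)) * (1 + suc (2 * q)) + (0 + (b + v * 2) * 2) +
    suc (2 * (2 * q)) * ((3 + 4 * (2 * q)) * (((b + u * 2) + (3 + 4 * (2 * q)) * (b + v * 2)) * (1 + suc (2 * q)))) ≡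
    (0 + (b + u * 2) * 2) +
      (8 * b + 48 * b * q + 104 * b * q * q + 64 * b * q * q * q + 18 * q * u + 78 * q * v +
       16 * q * q * u + 192 * q * q * v + 128 * q * q * q * v + 3 * u + 13 * v) * (4 * suc (2 * q))
  expand = solve-∀

-- Kinds of elements and the pattern graph

-- e, a^{2n}, the other a^i, the a^i b with i odd, and the a^i b with i even, which for odd n are
-- split by i mod 4 into evenCoset₀ and evenCoset₂.
data Kind : Set where
  identity central rotation oddCoset evenCoset₀ evenCoset₂ : Kind

-- One orientation of each edge of the pattern graph on kinds; `Linked` symmetrises it.
edge : Kind → Kind → Bool
edge identity   _          = true
edge central    central    = true
edge central    rotation   = true
edge central    oddCoset   = true
edge rotation   rotation   = true
edge oddCoset   oddCoset   = true
edge evenCoset₀ evenCoset₀ = true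
edge evenCoset₂ evenCoset₂ = true
edge _          _          = false

Linked : Kind → Kind → Set
Linked k l = T (edge k l ∨ edge l k)

open Labelled Linked

Linked-refl : ∀ k → Linked k k
Linked-refl identity   = tt
Linked-refl central    = tt
Linked-refl rotation   = tt
Linked-refl oddCoset   = tt
Linked-refl evenCoset₀ = tt
Linked-refl evenCoset₂ = tt

Linked-sym : ∀ k l → Linked k l → Linked l k
Linked-sym k l = subst T (∨-comm (edge k l) (edge l k))

Linked-identityʳ : ∀ k → Linked k identity
Linked-identityʳ k = subst T (sym (∨-zeroʳ (edge k identity))) tt

kindOf2Mod4 : Bool → Kind
kindOf2Mod4 true  = evenCoset₀
kindOf2Mod4 false = evenCoset₂

kindMod4 : Bool → ℕ → Kind
kindMod4 _ 0 = evenCoset₀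
kindMod4 b 2 = kindOf2Mod4 b
kindMod4 _ _ = oddCoset

kindMod4-odd : ∀ b {q} → q < 4 → q % 2 ≡ 1 → kindMod4 b q ≡ oddCoset
kindMod4-odd b {1} _ _ = refl
kindMod4-odd b {3} _ _ = refl
kindMod4-odd b {0} _ ()
kindMod4-odd b {2} _ ()
kindMod4-odd b {suc (suc (suc (suc _)))} (s≤s (s≤s (s≤s (s≤s ())))) _

kindMod4-true-even : ∀ {q} → q < 4 → q % 2 ≡ 0 → kindMod4 true q ≡ evenCoset₀
kindMod4-true-even {0} _ _ = refl
kindMod4-true-even {2} _ _ = refl
kindMod4-true-even {1} _ ()
kindMod4-true-even {3} _ ()
kindMod4-true-even {suc (suc (suc (suc _)))} (s≤s (s≤s (s≤s (s≤s ())))) _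

kindMod4-true-%2 : ∀ {q} → q < 4 → kindMod4 true q ≡ kindMod4 true (q % 2)
kindMod4-true-%2 {0} _ = refl
kindMod4-true-%2 {1} _ = refl
kindMod4-true-%2 {2} _ = refl
kindMod4-true-%2 {3} _ = refl
kindMod4-true-%2 {suc (suc (suc (suc _)))} (s≤s (s≤s (s≤s (s≤s ()))))

kindMod4-cong : ∀ b {q q′} → q < 4 → q′ < 4 → q % 2 ≡ q′ % 2 → (b ≡ false → q ≡ q′) →
  kindMod4 b q ≡ kindMod4 b q′
kindMod4-cong false _ _ _ q≡q′ = cong (kindMod4 false) (q≡q′ refl)
kindMod4-cong true q<4 q′<4 eq _ =
  trans (kindMod4-true-%2 q<4) (trans (cong (kindMod4 true) eq) (sym (kindMod4-true-%2 q′<4)))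

data KindMod4View (b : Bool) (j : ℕ) : Set where
  odd   : j % 2 ≡ 1 → kindMod4 b (j % 4) ≡ oddCoset → KindMod4View b j
  even₀ : j % 2 ≡ 0 → kindMod4 b (j % 4) ≡ evenCoset₀ → (b ≡ false → j % 4 ≡ 0) → KindMod4View b j
  even₂ : j % 2 ≡ 0 → kindMod4 b (j % 4) ≡ evenCoset₂ → b ≡ false → j % 4 ≡ 2 → KindMod4View b j

kindMod4-view : ∀ b j → KindMod4View b j
kindMod4-view b j with j % 4 in j%4≡ | m%n<n j 4
... | 0 | _ = even₀ (m%4%2⇒m%2 j (cong (_% 2) j%4≡)) (cong (kindMod4 b) j%4≡) (λ _ → j%4≡)
... | 1 | _ = odd (m%4%2⇒m%2 j (cong (_% 2) j%4≡)) (cong (kindMod4 b) j%4≡)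
... | 3 | _ = odd (m%4%2⇒m%2 j (cong (_% 2) j%4≡)) (cong (kindMod4 b) j%4≡)
kindMod4-view true  j | 2 | _ = even₀ (m%4%2⇒m%2 j (cong (_% 2) j%4≡)) (cong (kindMod4 true) j%4≡) (λ ())
kindMod4-view false j | 2 | _ = even₂ (m%4%2⇒m%2 j (cong (_% 2) j%4≡)) (cong (kindMod4 false) j%4≡) refl j%4≡
kindMod4-view b j | suc (suc (suc (suc _))) | s≤s (s≤s (s≤s (s≤s ())))

rotationKindBy : {A B : Set} → Dec A → Dec B → Kind
rotationKindBy (yes _) _       = identity
rotationKindBy (no _)  (yes _) = central
rotationKindBy (no _)  (no _)  = rotation

rotationKindBy-cong : ∀ {A B A′ B′ : Set} (a : Dec A) (b : Dec B) (a′ : Dec A′) (b′ : Dec B′) →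
  A ⇔ A′ → B ⇔ B′ → rotationKindBy a b ≡ rotationKindBy a′ b′
rotationKindBy-cong (yes _) _       (yes _) _       _     _     = refl
rotationKindBy-cong (yes x) _       (no ¬x) _       A⇔A′ _     = ⊥-elim (¬x (Equivalence.to A⇔A′ x))
rotationKindBy-cong (no ¬x) _       (yes x) _       A⇔A′ _     = ⊥-elim (¬x (Equivalence.from A⇔A′ x))
rotationKindBy-cong (no _)  (yes _) (no _)  (yes _) _     _     = refl
rotationKindBy-cong (no _)  (yes y) (no _)  (no ¬y) _     B⇔B′ = ⊥-elim (¬y (Equivalence.to B⇔B′ y))
rotationKindBy-cong (no _)  (no ¬y) (no _)  (yes y) _     B⇔B′ = ⊥-elim (¬y (Equivalence.from B⇔B′ y))
rotationKindBy-cong (no _)  (no _)  (no _)  (no _)  _     _     = refl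

rotationKindBy-central : ∀ {A B : Set} (a : Dec A) (b : Dec B) → ¬ A → B → rotationKindBy a b ≡ central
rotationKindBy-central (yes x) _      ¬x _ = ⊥-elim (¬x x)
rotationKindBy-central (no _) (yes _) _  _ = refl
rotationKindBy-central (no _) (no ¬y) _  y = ⊥-elim (¬y y)

RotationKindCases : (A B : Set) → Kind → Set
RotationKindCases A B k = (A × k ≡ identity) ⊎ (B × k ≡ central) ⊎ k ≡ rotation

rotationKindBy-cases : ∀ {A B : Set} (a : Dec A) (b : Dec B) → RotationKindCases A B (rotationKindBy a b)
rotationKindBy-cases (yes x) _       = inj₁ (x , refl)
rotationKindBy-cases (no _)  (yes y) = inj₂ (inj₁ (y , refl))
rotationKindBy-cases (no _)  (no _)  = inj₂ (inj₂ refl)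

rotationKindBy-Linked : ∀ {A B A′ B′ : Set} (a : Dec A) (b : Dec B) (a′ : Dec A′) (b′ : Dec B′) →
  Linked (rotationKindBy a b) (rotationKindBy a′ b′)
rotationKindBy-Linked (yes _) _       _       _       = tt
rotationKindBy-Linked (no _)  (yes _) (yes _) _       = tt
rotationKindBy-Linked (no _)  (yes _) (no _)  (yes _) = tt
rotationKindBy-Linked (no _)  (yes _) (no _)  (no _)  = tt
rotationKindBy-Linked (no _)  (no _)  (yes _) _       = tt
rotationKindBy-Linked (no _)  (no _)  (no _)  (yes _) = tt
rotationKindBy-Linked (no _)  (no _)  (no _)  (no _)  = tt

OddCyclicKind : Kind → Set
OddCyclicKind k = k ≡ identity ⊎ k ≡ central ⊎ k ≡ oddCoset

OddCyclicKind-Linked : ∀ {k l} → OddCyclicKind k → OddCyclicKind l → Linked k l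
OddCyclicKind-Linked (inj₁ refl)         _                   = tt
OddCyclicKind-Linked (inj₂ (inj₁ refl)) (inj₁ refl)         = tt
OddCyclicKind-Linked (inj₂ (inj₁ refl)) (inj₂ (inj₁ refl)) = tt
OddCyclicKind-Linked (inj₂ (inj₁ refl)) (inj₂ (inj₂ refl)) = tt
OddCyclicKind-Linked (inj₂ (inj₂ refl)) (inj₁ refl)         = tt
OddCyclicKind-Linked (inj₂ (inj₂ refl)) (inj₂ (inj₁ refl)) = tt
OddCyclicKind-Linked (inj₂ (inj₂ refl)) (inj₂ (inj₂ refl)) = tt

identity⊎≡-Linked : ∀ {k l K} → k ≡ identity ⊎ k ≡ K → l ≡ identity ⊎ l ≡ K → Linked k l
identity⊎≡-Linked (inj₁ refl) _                   = tt
identity⊎≡-Linked {K = K} (inj₂ refl) (inj₁ refl) = Linked-identityʳ K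
identity⊎≡-Linked {K = K} (inj₂ refl) (inj₂ refl) = Linked-refl K

-- `Parity b p` says that n = suc p is even exactly when b is true.
Parity : Bool → ℕ → Set
Parity true  p = ∃ λ r → p ≡ suc (2 * r)
Parity false p = ∃ λ q → p ≡ 2 * q

Parity-true : ∀ {b p} → Parity b p → b ≡ true → ∃ λ r → p ≡ suc (2 * r)
Parity-true {true} par _ = par

Parity-false : ∀ {b p} → Parity b p → b ≡ false → ∃ λ q → p ≡ 2 * q
Parity-false {false} par _ = par

module Kinds (p : ℕ) (nEven : Bool) (parity : Parity nEven p) where
  open Semidihedral p public

  rotationKind : ℕ → Kind
  rotationKind j = rotationKindBy (j ≟ 0) (j ≟ 2 * n)

  cosetKind : ℕ → Kind
  cosetKind j = kindMod4 nEven (j % 4)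

  kind : El → Kind
  kind (i , false) = rotationKind (toℕ i)
  kind (i , true)  = cosetKind (toℕ i)

  M*M*j≋j : ∀ j → M * (M * j) ≋ j
  M*M*j≋j j = ≡⇒≋ (substM (λ m → m * (m * j) ≡ j + (p * j) * N) (expand p j)) ⨾ m+k*d≋m j (p * j)
    where
    expand : ∀ p j → suc (2 * p) * (suc (2 * p) * j) ≡ j + (p * j) * (4 * suc p)
    expand = solve-∀

  M*2n≋2n : M * (2 * n) ≋ 2 * n
  M*2n≋2n = ≡⇒≋ (substM (λ m → m * (2 * n) ≡ 2 * n + p * N) (expand p)) ⨾ m+k*d≋m (2 * n) p
    where
    expand : ∀ p → suc (2 * p) * (2 * suc p) ≡ 2 * suc p + p * (4 * suc p)
    expand = solve-∀

  M*-involutive : ∀ j → j < N → (M * ((M * j) % N)) % N ≡ j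
  M*-involutive j j<N = sym (<∧≋⇒≡% j<N (≋-sym (*≋*ˡ M (m%d≋m (M * j)) ⨾ M*M*j≋j j)))

  rotationKind-M* : ∀ j → j < N → rotationKind ((M * j) % N) ≡ rotationKind j
  rotationKind-M* j j<N = rotationKindBy-cong (Mj ≟ 0) (Mj ≟ 2 * n) (j ≟ 0) (j ≟ 2 * n)
    (mk⇔ (λ Mj≡0 → trans (sym (M*-involutive j j<N)) (M*-fixes 0 M*0%N Mj≡0))
         (λ { refl → M*0%N }))
    (mk⇔ (λ Mj≡2n → trans (sym (M*-involutive j j<N)) (M*-fixes (2 * n) M*2n%N Mj≡2n))
         (λ { refl → M*2n%N }))
    where
    Mj : ℕ
    Mj = (M * j) % N
    M*0%N : (M * 0) % N ≡ 0
    M*0%N = cong (_% N) (*-zeroʳ M)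
    M*2n%N : (M * (2 * n)) % N ≡ 2 * n
    M*2n%N = sym (<∧≋⇒≡% 2n<N (≋-sym M*2n≋2n))
    M*-fixes : ∀ k → (M * k) % N ≡ k → Mj ≡ k → (M * Mj) % N ≡ k
    M*-fixes k fixed refl = fixed

  cosetKind-cong : ∀ i j → i % 2 ≡ j % 2 → (nEven ≡ false → i % 4 ≡ j % 4) →
    cosetKind i ≡ cosetKind j
  cosetKind-cong i j i≡j[2] i≡j[4] = kindMod4-cong nEven (m%n<n i 4) (m%n<n j 4)
    (trans (m%4%2≡m%2 i) (trans i≡j[2] (sym (m%4%2≡m%2 j)))) i≡j[4]

  exp-inverse : ∀ g h → g · h ≡ e → exp g + twist g (exp h) ≋ 0
  exp-inverse g h gh≡e = ≋-sym (exp-·-≋ g h) ⨾ ≡⇒≋ (cong exp gh≡e)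

  %2-shift : ∀ R j Z X Y → R + X * 2 ≋ (j + Z) + Y * 2 → Z ≋ 0 → R % 2 ≡ j % 2
  %2-shift R j Z X Y R≋ Z≋0 = M₂.%-≡ (
    M₂.≋-sym (M₂.m+k*d≋m R X) M₂.⨾ M₂.mk≋ (∣∧≋⇒%≡ 2 2∣N R≋) M₂.⨾
    M₂.m+k*d≋m (j + Z) Y M₂.⨾
    M₂.+≋+ˡ j (M₂.mk≋ (∣∧≋⇒%≡ 2 2∣N Z≋0)) M₂.⨾ M₂.≡⇒≋ (+-identityʳ j))
    where module M₂ = Congruence 2

  -- For odd n, p is even, so the shifts by 2p·c vanish modulo 4.
  %4-shift : ∀ R j Z c c′ → R + (p * c) * 2 ≋ (j + Z) + (p * c′) * 2 → Z ≋ 0 → nEven ≡ false →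
    R % 4 ≡ j % 4
  %4-shift R j Z c c′ R≋ Z≋0 odd-n with Parity-false parity odd-n
  ... | q , p≡2q = M₄.%-≡ (
    M₄.≋-sym (M₄.m+k*d≋m R (q * c)) M₄.⨾ M₄.≡⇒≋ (cong (R +_) (sym (2p≡4q c))) M₄.⨾
    M₄.mk≋ (∣∧≋⇒%≡ 4 4∣N R≋) M₄.⨾ M₄.≡⇒≋ (cong ((j + Z) +_) (2p≡4q c′)) M₄.⨾
    M₄.m+k*d≋m (j + Z) (q * c′) M₄.⨾ M₄.+≋+ˡ j (M₄.mk≋ (∣∧≋⇒%≡ 4 4∣N Z≋0)) M₄.⨾
    M₄.≡⇒≋ (+-identityʳ j))
    where
    module M₄ = Congruence 4
    2q*2≡q*4 : ∀ q c → (2 * q * c) * 2 ≡ (q * c) * 4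
    2q*2≡q*4 = solve-∀
    2p≡4q : ∀ c → (p * c) * 2 ≡ (q * c) * 4
    2p≡4q c = trans (cong (λ y → (y * c) * 2) p≡2q) (2q*2≡q*4 q c)

  rotation-conj-rotation : ∀ a c j → (a , false) · (c , false) ≡ e →
    ((a , false) · (j , false)) · (c , false) ≡ (j , false)
  rotation-conj-rotation a c j gh≡e = El-ext-≋ {((g · x) · h)} {x} (
    exp-·-≋ (g · x) h ⨾ +≋+ʳ (toℕ c) (exp-·-≋ g x) ⨾
    ≡⇒≋ (rearrange (toℕ a) (toℕ j) (toℕ c)) ⨾
    +≋+ˡ (toℕ j) (exp-inverse g h gh≡e) ⨾ ≡⇒≋ (+-identityʳ (toℕ j))) refl
    where
    g h x : El
    g = a , false
    h = c , false
    x = j , false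
    rearrange : ∀ a j c → a + j + c ≡ j + (a + c)
    rearrange = solve-∀

  exp-coset-conj-rotation : ∀ a c j → (a , true) · (c , true) ≡ e →
    exp (((a , true) · (j , false)) · (c , true)) ≋ M * toℕ j
  exp-coset-conj-rotation a c j gh≡e =
    exp-·-≋ (g · x) h ⨾ +≋+ʳ (M * toℕ c) (exp-·-≋ g x) ⨾
    ≡⇒≋ (rearrange (toℕ a) (toℕ j) (toℕ c) M) ⨾
    +≋+ˡ (M * toℕ j) (exp-inverse g h gh≡e) ⨾ ≡⇒≋ (+-identityʳ (M * toℕ j))
    where
    g h x : El
    g = a , true
    h = c , true
    x = j , false
    rearrange : ∀ a j c m → a + m * j + m * c ≡ m * j + (a + m * c)
    rearrange = solve-∀

  rotation-conj-coset : ∀ a c j → (a , false) · (c , false) ≡ e →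
    cosetKind (exp (((a , false) · (j , true)) · (c , false))) ≡ cosetKind (toℕ j)
  rotation-conj-coset a c j gh≡e =
    cosetKind-cong R (toℕ j) (%2-shift R (toℕ j) Z 0 (p * toℕ c) R+0≋ Z≋0)
                             (%4-shift R (toℕ j) Z 0 (toℕ c) R+p0≋ Z≋0)
    where
    g h x : El
    g = a , false
    h = c , false
    x = j , true
    R Z : ℕ
    R = exp ((g · x) · h)
    Z = toℕ a + toℕ c
    Z≋0 : Z ≋ 0
    Z≋0 = exp-inverse g h gh≡e
    rearrange : ∀ a j c p → a + j + suc (2 * p) * c ≡ j + (a + c) + (p * c) * 2
    rearrange = solve-∀
    R≋ : R ≋ toℕ j + Z + (p * toℕ c) * 2
    R≋ = exp-·-≋ (g · x) h ⨾ +≋+ʳ (M * toℕ c) (exp-·-≋ g x) ⨾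
         ≡⇒≋ (substM (λ m → toℕ a + toℕ j + m * toℕ c ≡ toℕ j + Z + (p * toℕ c) * 2)
                     (rearrange (toℕ a) (toℕ j) (toℕ c) p))
    R+0≋ : R + 0 * 2 ≋ toℕ j + Z + (p * toℕ c) * 2
    R+0≋ = ≡⇒≋ (+-identityʳ R) ⨾ R≋
    R+p0≋ : R + (p * 0) * 2 ≋ toℕ j + Z + (p * toℕ c) * 2
    R+p0≋ = ≡⇒≋ (trans (cong (λ y → R + y * 2) (*-zeroʳ p)) (+-identityʳ R)) ⨾ R≋

  coset-conj-coset : ∀ a c j → (a , true) · (c , true) ≡ e →
    cosetKind (exp (((a , true) · (j , true)) · (c , true))) ≡ cosetKind (toℕ j)
  coset-conj-coset a c j gh≡e =
    cosetKind-cong R (toℕ j) (%2-shift R (toℕ j) Z (p * toℕ c) (p * toℕ j) R≋ Z≋0)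
                             (%4-shift R (toℕ j) Z (toℕ c) (toℕ j) R≋ Z≋0)
    where
    g h x : El
    g = a , true
    h = c , true
    x = j , true
    R Z : ℕ
    R = exp ((g · x) · h)
    Z = toℕ a + M * toℕ c
    Z≋0 : Z ≋ 0
    Z≋0 = exp-inverse g h gh≡e
    rearrange : ∀ a j c p →
      a + suc (2 * p) * j + c + (p * c) * 2 ≡ (j + (a + suc (2 * p) * c)) + (p * j) * 2
    rearrange = solve-∀
    R≋ : R + (p * toℕ c) * 2 ≋ toℕ j + Z + (p * toℕ j) * 2
    R≋ = +≋+ʳ ((p * toℕ c) * 2) (exp-·-≋ (g · x) h ⨾ +≋+ʳ (toℕ c) (exp-·-≋ g x)) ⨾
         ≡⇒≋ (substM (λ m → toℕ a + m * toℕ j + toℕ c + (p * toℕ c) * 2 ≡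
                            (toℕ j + (toℕ a + m * toℕ c)) + (p * toℕ j) * 2)
                     (rearrange (toℕ a) (toℕ j) (toℕ c) p))

  kind-conj : ∀ g h x → g · h ≡ e → kind ((g · x) · h) ≡ kind x
  kind-conj (a , false) (c , true) _ gh≡e with cong proj₂ gh≡e
  ... | ()
  kind-conj (a , true) (c , false) _ gh≡e with cong proj₂ gh≡e
  ... | ()
  kind-conj (a , false) (c , false) (j , false) gh≡e = cong kind (rotation-conj-rotation a c j gh≡e)
  kind-conj (a , true) (c , true) (j , false) gh≡e =
    trans (cong rotationKind (<∧≋⇒≡% (exp<N (((a , true) · (j , false)) · (c , true)))
                                      (exp-coset-conj-rotation a c j gh≡e)))
          (rotationKind-M* (toℕ j) (toℕ<n j))
  kind-conj (a , false) (c , false) (j , true) gh≡e = rotation-conj-coset a c j gh≡e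
  kind-conj (a , true) (c , true) (j , true) gh≡e = coset-conj-coset a c j gh≡e

  rotationKind-2n : rotationKind (2 * n) ≡ central
  rotationKind-2n = rotationKindBy-central (2 * n ≟ 0) (2 * n ≟ 2 * n) (λ ()) refl

  2n*w≋2n*[w%2] : ∀ w → 2 * n * w ≋ 2 * n * (w % 2)
  2n*w≋2n*[w%2] w = ≡⇒≋ (trans (cong (2 * n *_) (m≡m%n+[m/n]*n w 2)) (expand p (w % 2) (w / 2))) ⨾
                    m+k*d≋m (2 * n * (w % 2)) (w / 2)
    where
    expand : ∀ p r u → 2 * suc p * (r + u * 2) ≡ 2 * suc p * r + u * (4 * suc p)
    expand = solve-∀

  2n*w≡0⊎2n : ∀ {J} w → J < N → J ≋ 2 * n * w → J ≡ 0 ⊎ J ≡ 2 * n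
  2n*w≡0⊎2n {J} w J<N J≋ with %2≡0⊎%2≡1 w | <∧≋⇒≡% J<N (J≋ ⨾ 2n*w≋2n*[w%2] w)
  ... | inj₁ w%2≡0 | J≡ = inj₁ (begin
    J                       ≡⟨ J≡ ⟩
    (2 * n * (w % 2)) % N   ≡⟨ cong (λ x → (2 * n * x) % N) w%2≡0 ⟩
    (2 * n * 0) % N         ≡⟨ cong (_% N) (*-zeroʳ (2 * n)) ⟩
    0                       ∎)
    where open ≡-Reasoning
  ... | inj₂ w%2≡1 | J≡ = inj₂ (begin
    J                       ≡⟨ J≡ ⟩
    (2 * n * (w % 2)) % N   ≡⟨ cong (λ x → (2 * n * x) % N) w%2≡1 ⟩
    (2 * n * 1) % N         ≡⟨ cong (_% N) (*-identityʳ (2 * n)) ⟩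
    (2 * n) % N             ≡⟨ m<n⇒m%n≡m 2n<N ⟩
    2 * n                   ∎)
    where open ≡-Reasoning

  odd-split : ∀ (i : Fin N) → toℕ i % 2 ≡ 1 → toℕ i ≡ 1 + (toℕ i / 2) * 2
  odd-split i i-odd = trans (m≡m%n+[m/n]*n (toℕ i) 2) (cong (_+ (toℕ i / 2) * 2) i-odd)

  even-split : ∀ (i : Fin N) → toℕ i % 2 ≡ 0 → toℕ i ≡ 0 + (toℕ i / 2) * 2
  even-split i i-even = trans (m≡m%n+[m/n]*n (toℕ i) 2) (cong (_+ (toℕ i / 2) * 2) i-even)

  PowerOf : Fin N → El → Set
  PowerOf i (J , false) = ∃ λ d → toℕ J ≋ 2 * n * (toℕ i * d)
  PowerOf i (J , true)  = ∃ λ d → toℕ J ≋ toℕ i + 2 * n * (toℕ i * d)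

  pow-PowerOf : ∀ i k → PowerOf i (pow (i , true) k)
  pow-PowerOf i zero = 0 , ≡⇒≋ (sym (trans (cong (2 * n *_) (*-zeroʳ (toℕ i))) (*-zeroʳ (2 * n))))
  pow-PowerOf i (suc k) with pow (i , true) k | pow-PowerOf i k
  ... | J , false | d , J≋ = M * d ,
    (exp-·-≋ (i , true) (J , false) ⨾ +≋+ˡ (toℕ i) (*≋*ˡ M J≋) ⨾
     ≡⇒≋ (reassoc (toℕ i) d M (2 * n)))
    where
    reassoc : ∀ i d m n₂ → i + m * (n₂ * (i * d)) ≡ i + n₂ * (i * (m * d))
    reassoc = solve-∀
  ... | J , true | d , J≋ = suc (M * d) ,
    (exp-·-≋ (i , true) (J , true) ⨾ +≋+ˡ (toℕ i) (*≋*ˡ M J≋) ⨾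
     ≡⇒≋ (substM (λ m → toℕ i + m * (toℕ i + 2 * n * (toℕ i * d)) ≡
                        2 * n * (toℕ i * suc (m * d)))
                 (expand p (toℕ i) d)))
    where
    expand : ∀ p i d → i + suc (2 * p) * (i + 2 * suc p * (i * d)) ≡ 2 * suc p * (i * suc (suc (2 * p) * d))
    expand = solve-∀

  kind-PowerOf-odd : ∀ i → toℕ i % 2 ≡ 1 → ∀ w → PowerOf i w → OddCyclicKind (kind w)
  kind-PowerOf-odd i _ (J , false) (d , J≋) with 2n*w≡0⊎2n (toℕ i * d) (toℕ<n J) J≋
  ... | inj₁ J≡0  = inj₁ (cong rotationKind J≡0)
  ... | inj₂ J≡2n = inj₂ (inj₁ (trans (cong rotationKind J≡2n) rotationKind-2n))
  kind-PowerOf-odd i i-odd (J , true) (d , J≋) =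
    inj₂ (inj₂ (kindMod4-odd nEven (m%n<n (toℕ J) 4) (trans (m%4%2≡m%2 (toℕ J)) (trans J≡i[2] i-odd))))
    where
    module M₂ = Congruence 2
    regroup : ∀ p i d → i + 2 * suc p * (i * d) ≡ i + (suc p * (i * d)) * 2
    regroup = solve-∀
    J≡i[2] : toℕ J % 2 ≡ toℕ i % 2
    J≡i[2] = trans (∣∧≋⇒%≡ 2 2∣N (J≋ ⨾ ≡⇒≋ (regroup p (toℕ i) d)))
                   (M₂.%-≡ (M₂.m+k*d≋m (toℕ i) (suc p * (toℕ i * d))))

  kind-PowerOf-even : ∀ i → toℕ i % 2 ≡ 0 → ∀ w → PowerOf i w →
    kind w ≡ identity ⊎ kind w ≡ cosetKind (toℕ i)
  kind-PowerOf-even i i-even (J , false) (d , J≋) = inj₁ (cong rotationKind (<∧≋⇒≡% (toℕ<n J)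
    (J≋ ⨾ ≡⇒≋ (cong (λ x → 2 * n * (x * d)) (even-split i i-even)) ⨾ ≡⇒≋ (expand p (toℕ i / 2) d) ⨾
     m+k*d≋m 0 ((toℕ i / 2) * d))))
    where
    expand : ∀ p u d → 2 * suc p * ((0 + u * 2) * d) ≡ 0 + (u * d) * (4 * suc p)
    expand = solve-∀
  kind-PowerOf-even i i-even (J , true) (d , J≋) = inj₂ (cong cosetKind (<∧<∧≋⇒≡ (toℕ<n J) (toℕ<n i)
    (J≋ ⨾ ≡⇒≋ (cong (λ x → x + 2 * n * (x * d)) (even-split i i-even)) ⨾ ≡⇒≋ (expand p (toℕ i / 2) d) ⨾
     m+k*d≋m _ ((toℕ i / 2) * d) ⨾ ≡⇒≋ (sym (even-split i i-even)))))
    where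
    expand : ∀ p u d → (0 + u * 2) + 2 * suc p * ((0 + u * 2) * d) ≡ (0 + u * 2) + (u * d) * (4 * suc p)
    expand = solve-∀

  proj₂-pow-rotation : ∀ i k → proj₂ (pow (i , false) k) ≡ false
  proj₂-pow-rotation i zero    = refl
  proj₂-pow-rotation i (suc k) = proj₂-pow-rotation i k

  rotations-Linked : ∀ w w′ → proj₂ w ≡ false → proj₂ w′ ≡ false → Linked (kind w) (kind w′)
  rotations-Linked (J , false) (J′ , false) refl refl =
    rotationKindBy-Linked (toℕ J ≟ 0) (toℕ J ≟ 2 * n) (toℕ J′ ≟ 0) (toℕ J′ ≟ 2 * n)

  pow-Linked : ∀ z k m → Linked (kind (pow z k)) (kind (pow z m))
  pow-Linked (i , false) k m =
    rotations-Linked (pow (i , false) k) (pow (i , false) m) (proj₂-pow-rotation i k) (proj₂-pow-rotation i m)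
  pow-Linked (i , true) k m with %2≡0⊎%2≡1 (toℕ i)
  ... | inj₁ i-even = identity⊎≡-Linked (kind-PowerOf-even i i-even _ (pow-PowerOf i k))
                                         (kind-PowerOf-even i i-even _ (pow-PowerOf i m))
  ... | inj₂ i-odd  = OddCyclicKind-Linked (kind-PowerOf-odd i i-odd _ (pow-PowerOf i k))
                                           (kind-PowerOf-odd i i-odd _ (pow-PowerOf i m))

  ConjCyclic : El → El → Set
  ConjCyclic x y = ∃[ x′ ] ∃[ y′ ] (Conj x x′ × Conj y y′ × InCommonCyclic x′ y′)

  ConjCyclic⇒Linked : ∀ x y → ConjCyclic x y → Linked (kind x) (kind y)
  ConjCyclic⇒Linked x y
    (_ , _ , (g , h , gh≡e , x′≡) , (g′ , h′ , gh≡e′ , y′≡) , (z , (k , zᵏ≡x′) , (m , zᵐ≡y′))) =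
    subst₂ Linked (trans (cong kind (trans zᵏ≡x′ x′≡)) (kind-conj g h x gh≡e))
                  (trans (cong kind (trans zᵐ≡y′ y′≡)) (kind-conj g′ h′ y gh≡e′))
                  (pow-Linked z k m)

  Conj-refl : ∀ x → Conj x x
  Conj-refl x = e , e , refl , sym (trans (·-identityʳ (e · x)) (·-identityˡ x))

  ConjCyclic-sym : ∀ {x y} → ConjCyclic x y → ConjCyclic y x
  ConjCyclic-sym (x′ , y′ , x~x′ , y~y′ , (z , zᵏ≡x′ , zᵐ≡y′)) =
    y′ , x′ , y~y′ , x~x′ , (z , zᵐ≡y′ , zᵏ≡x′)

  ConjCyclic-identity : ∀ i y → toℕ i ≡ 0 → ConjCyclic (i , false) y
  ConjCyclic-identity i y i≡0 =
    (i , false) , y , Conj-refl _ , Conj-refl _ , (y , (0 , El-ext {e} (sym i≡0) refl) , (1 , ·-identityʳ y))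

  1<N : 1 < N
  1<N = s≤s (≤-trans (s≤s z≤n) (m≤n+m (3 * n) p))

  a : El
  a = fromℕ< 1<N , false

  exp-pow-a : ∀ k → exp (pow a k) ≋ k
  exp-pow-a zero    = ≋-refl
  exp-pow-a (suc k) = exp-·-≋ a (pow a k) ⨾ +≋+ (≡⇒≋ (toℕ-fromℕ< 1<N)) (exp-pow-a k)

  proj₂-pow-a : ∀ k → proj₂ (pow a k) ≡ false
  proj₂-pow-a zero    = refl
  proj₂-pow-a (suc k) = proj₂-pow-a k

  ConjCyclic-rotations : ∀ i j → ConjCyclic (i , false) (j , false)
  ConjCyclic-rotations i j =
    (i , false) , (j , false) , Conj-refl _ , Conj-refl _ , (a , (toℕ i , pow-a i) , (toℕ j , pow-a j))
    where
    pow-a : ∀ i → pow a (toℕ i) ≡ (i , false)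
    pow-a i =
      El-ext (<∧<∧≋⇒≡ (exp<N (pow a (toℕ i))) (toℕ<n i) (exp-pow-a (toℕ i))) (proj₂-pow-a (toℕ i))

  -- a^{2n} = (a^j b)^2 for odd j.
  ConjCyclic-central-odd : ∀ i j → toℕ i ≡ 2 * n → toℕ j % 2 ≡ 1 → ConjCyclic (i , false) (j , true)
  ConjCyclic-central-odd i j i≡2n j-odd =
    (i , false) , y , Conj-refl _ , Conj-refl _ , (y , (2 , y²≡) , (1 , ·-identityʳ y))
    where
    y : El
    y = j , true
    expand : ∀ p j → j + suc (2 * p) * j ≡ 2 * suc p * j
    expand = solve-∀
    exp-y·y : exp (y · y) ≋ 2 * n
    exp-y·y = exp-·-≋ y y ⨾
              ≡⇒≋ (substM (λ m → toℕ j + m * toℕ j ≡ 2 * n * toℕ j) (expand p (toℕ j))) ⨾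
              2n*w≋2n*[w%2] (toℕ j) ⨾ ≡⇒≋ (trans (cong (2 * n *_) j-odd) (*-identityʳ (2 * n)))
    y²≡ : pow y 2 ≡ (i , false)
    y²≡ = trans (cong (y ·_) (·-identityʳ y))
                (El-ext (trans (<∧≋⇒≡% (exp<N (y · y)) exp-y·y) (trans (m<n⇒m%n≡m 2n<N) (sym i≡2n)))
                        refl)

  OddPower : Fin N → ℕ → El → Set
  OddPower i d w = (exp w ≋ toℕ i + 2 * n * (toℕ i * d)) × proj₂ w ≡ true

  pow-OddPower : ∀ i d → OddPower i d (pow (i , true) (1 + 2 * d))
  pow-OddPower i zero =
    ≡⇒≋ (trans (cong exp (·-identityʳ x)) (vanish (toℕ i) (2 * n))) , cong proj₂ (·-identityʳ x)
    where
    x : El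
    x = i , true
    vanish : ∀ i m → i ≡ i + m * (i * 0)
    vanish = solve-∀
  pow-OddPower i (suc d) = subst (OddPower i (suc d)) (cong (pow x) (sym (1+2[1+d] d)))
                                 (two-more (pow x (1 + 2 * d)) (pow-OddPower i d))
    where
    x : El
    x = i , true
    1+2[1+d] : ∀ d → 1 + 2 * suc d ≡ suc (suc (1 + 2 * d))
    1+2[1+d] = solve-∀
    expand : ∀ p i d → i + suc (2 * p) * (i + suc (2 * p) * (i + 2 * suc p * (i * d))) ≡
      (i + 2 * suc p * (i * suc d)) + (p * i + p * (2 * suc p * (i * d))) * (4 * suc p)
    expand = solve-∀
    two-more : ∀ w → OddPower i d w → OddPower i (suc d) (x · (x · w))
    two-more (J , true) (J≋ , refl) =
      (exp-·-≋ x (x · (J , true)) ⨾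
       +≋+ˡ (toℕ i) (*≋*ˡ M (exp-·-≋ x (J , true) ⨾ +≋+ˡ (toℕ i) (*≋*ˡ M J≋))) ⨾
       ≡⇒≋ (substM (λ m → toℕ i + m * (toℕ i + m * (toℕ i + 2 * n * (toℕ i * d))) ≡
                          (toℕ i + 2 * n * (toℕ i * suc d)) + (p * toℕ i + p * (2 * n * (toℕ i * d))) * N)
                   (expand p (toℕ i) d)) ⨾
       m+k*d≋m (toℕ i + 2 * n * (toℕ i * suc d)) (p * toℕ i + p * (2 * n * (toℕ i * d)))) , refl

  N-1 : ℕ
  N-1 = 3 + 4 * p

  rot rot⁻¹ : ℕ → El
  rot κ = (κ mod N) , false
  rot⁻¹ κ = ((N-1 * κ) mod N) , false

  exp-rot : ∀ κ → toℕ (κ mod N) ≋ κ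
  exp-rot κ = ≡⇒≋ (toℕ-fromℕ< (m%n<n κ N)) ⨾ m%d≋m κ

  Conj-rot : ∀ κ y → Conj y ((rot κ · y) · rot⁻¹ κ)
  Conj-rot κ y = rot κ , rot⁻¹ κ , rot·rot⁻¹≡e , refl
    where
    κ+[N-1]κ : ∀ p κ → κ + (3 + 4 * p) * κ ≡ 0 + κ * (4 * suc p)
    κ+[N-1]κ = solve-∀
    rot·rot⁻¹≡e : rot κ · rot⁻¹ κ ≡ e
    rot·rot⁻¹≡e = El-ext (<∧≋⇒≡% (exp<N (rot κ · rot⁻¹ κ))
      (exp-·-≋ (rot κ) (rot⁻¹ κ) ⨾ +≋+ (exp-rot κ) (exp-rot (N-1 * κ)) ⨾ ≡⇒≋ (κ+[N-1]κ p κ) ⨾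
       m+k*d≋m 0 κ)) refl

  exp-Conj-rot : ∀ κ j → exp ((rot κ · (j , true)) · rot⁻¹ κ) ≋ κ + toℕ j + M * (N-1 * κ)
  exp-Conj-rot κ j = exp-·-≋ (rot κ · (j , true)) (rot⁻¹ κ) ⨾
    +≋+ (exp-·-≋ (rot κ) (j , true) ⨾ +≋+ʳ (toℕ j) (exp-rot κ)) (*≋*ˡ M (exp-rot (N-1 * κ)))

  -- With i = 1 + 2s and j = 1 + 2t, a^{s-t} conjugates a^j b to a^{i - 2n(s-t)} b = (a^i b)^{1+2(s+t)}.
  ConjCyclic-odd : ∀ i j → toℕ i % 2 ≡ 1 → toℕ j % 2 ≡ 1 → ConjCyclic (i , true) (j , true)
  ConjCyclic-odd i j i-odd j-odd =
    x , y′ , Conj-refl x , Conj-rot κ (j , true) , (x , (1 , ·-identityʳ x) , (1 + 2 * d , sym y′≡))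
    where
    x : El
    x = i , true
    s t κ d : ℕ
    s = toℕ i / 2
    t = toℕ j / 2
    κ = s + N-1 * t
    d = s + t
    y′ : El
    y′ = (rot κ · (j , true)) · rot⁻¹ κ
    expand : ∀ p s t →
      (s + (3 + 4 * p) * t) + (1 + t * 2) + suc (2 * p) * ((3 + 4 * p) * (s + (3 + 4 * p) * t)) +
        (s * t + s * s) * (4 * suc p) ≡
      (1 + s * 2) + 2 * suc p * ((1 + s * 2) * (s + t)) +
        (2 * p * s + 8 * p * t + 8 * p * p * t + 3 * t) * (4 * suc p)
    expand = solve-∀
    exp-y′ : exp y′ ≋ toℕ i + 2 * n * (toℕ i * d)
    exp-y′ = exp-Conj-rot κ j ⨾ ≡⇒≋ (cong (λ J → κ + J + M * (N-1 * κ)) (odd-split j j-odd)) ⨾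
      m+k*d≡n+l*d⇒m≋n (s * t + s * s) (2 * p * s + 8 * p * t + 8 * p * p * t + 3 * t)
        (substM (λ m → κ + (1 + t * 2) + m * (N-1 * κ) + (s * t + s * s) * N ≡
                       (1 + s * 2) + 2 * n * ((1 + s * 2) * d) +
                         (2 * p * s + 8 * p * t + 8 * p * p * t + 3 * t) * N)
                (expand p s t)) ⨾
      ≡⇒≋ (cong (λ I → I + 2 * n * (I * d)) (sym (odd-split i i-odd)))
    y′≡ : y′ ≡ pow x (1 + 2 * d)
    y′≡ = El-ext-≋ {y′} {pow x (1 + 2 * d)} (exp-y′ ⨾ ≋-sym (proj₁ (pow-OddPower i d)))
                   (sym (proj₂ (pow-OddPower i d)))

  -- With i = 2s and j = 2t, conjugation by a^κ, κ = (s - t)(1 + n), adds κ(1 - M) = 2(s - t)(1 - n²) to the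
  -- exponent of a^j b; this is i - j modulo 4n when n is even, or when n is odd and s ≡ t (mod 2).
  ConjCyclic-even : ∀ i j → toℕ i % 2 ≡ 0 → toℕ j % 2 ≡ 0 → (nEven ≡ false → toℕ i % 4 ≡ toℕ j % 4) →
    ConjCyclic (i , true) (j , true)
  ConjCyclic-even i j i-even j-even i≡j[4] =
    x , y′ , Conj-refl x , Conj-rot κ (j , true) ,
    (x , (1 , ·-identityʳ x) , (1 , trans (·-identityʳ x) (sym y′≡x)))
    where
    x y′ : El
    x = i , true
    s t κ : ℕ
    s = toℕ i / 2
    t = toℕ j / 2
    κ = (s + N-1 * t) * (1 + n)
    y′ = (rot κ · (j , true)) · rot⁻¹ κ

    shifts-for : ∀ b → nEven ≡ b → ConjShift p s t
    shifts-for true n-even with Parity-true parity n-even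
    ... | r , p≡1+2r = subst (λ P → ConjShift P s t) (sym p≡1+2r) (conjShift-even r s t)
    shifts-for false n-odd with Parity-false parity n-odd
    ... | q , p≡2q = subst (λ P → ConjShift P s t) (sym p≡2q)
         (subst₂ (ConjShift (2 * q)) (sym s≡) (sym t≡) (conjShift-odd q (s % 2) (s / 2) (t / 2)))
      where
      s≡t[2] : (s % 2) * 2 ≡ (t % 2) * 2
      s≡t[2] = trans (sym ([s*2]%4≡[s%2]*2 s))
        (trans (cong (_% 4) (sym (even-split i i-even)))
        (trans (i≡j[4] n-odd)
        (trans (cong (_% 4) (even-split j j-even)) ([s*2]%4≡[s%2]*2 t))))
      s≡ : s ≡ s % 2 + (s / 2) * 2
      s≡ = m≡m%n+[m/n]*n s 2
      t≡ : t ≡ s % 2 + (t / 2) * 2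
      t≡ = trans (m≡m%n+[m/n]*n t 2) (cong (_+ (t / 2) * 2) (sym (*-cancelʳ-≡ (s % 2) (t % 2) 2 s≡t[2])))

    shifts : ConjShift p s t
    shifts = shifts-for nEven refl

    exp-y′ : exp y′ ≋ toℕ i
    exp-y′ = exp-Conj-rot κ j ⨾ ≡⇒≋ (cong (λ J → κ + J + M * (N-1 * κ)) (even-split j j-even)) ⨾
      ≡⇒≋ (substM (λ m → κ + (0 + t * 2) + m * (N-1 * κ) ≡ conjExponent p s t) refl) ⨾
      m+k*d≡n+l*d⇒m≋n 0 (proj₁ shifts) (trans (+-identityʳ (conjExponent p s t)) (proj₂ shifts)) ⨾
      ≡⇒≋ (sym (even-split i i-even))
    y′≡x : y′ ≡ x
    y′≡x = El-ext-≋ {y′} {x} exp-y′ refl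

  Linked⇒ConjCyclic-rotation-coset : ∀ i j → Linked (kind (i , false)) (kind (j , true)) →
    ConjCyclic (i , false) (j , true)
  Linked⇒ConjCyclic-rotation-coset i j linked
    with rotationKindBy-cases (toℕ i ≟ 0) (toℕ i ≟ 2 * n) | kindMod4-view nEven (toℕ j)
  ... | inj₁ (i≡0 , _)        | _                 = ConjCyclic-identity i _ i≡0
  ... | inj₂ (inj₁ (i≡2n , _)) | odd j-odd _      = ConjCyclic-central-odd i j i≡2n j-odd
  ... | inj₂ (inj₁ (_ , k≡))  | even₀ _ l≡ _      = ⊥-elim (subst₂ Linked k≡ l≡ linked)
  ... | inj₂ (inj₁ (_ , k≡))  | even₂ _ l≡ _ _    = ⊥-elim (subst₂ Linked k≡ l≡ linked)
  ... | inj₂ (inj₂ k≡)        | odd _ l≡          = ⊥-elim (subst₂ Linked k≡ l≡ linked)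
  ... | inj₂ (inj₂ k≡)        | even₀ _ l≡ _      = ⊥-elim (subst₂ Linked k≡ l≡ linked)
  ... | inj₂ (inj₂ k≡)        | even₂ _ l≡ _ _    = ⊥-elim (subst₂ Linked k≡ l≡ linked)

  Linked⇒ConjCyclic : ∀ x y → Linked (kind x) (kind y) → ConjCyclic x y
  Linked⇒ConjCyclic (i , false) (j , false) _      = ConjCyclic-rotations i j
  Linked⇒ConjCyclic (i , false) (j , true)  linked = Linked⇒ConjCyclic-rotation-coset i j linked
  Linked⇒ConjCyclic (i , true)  (j , false) linked =
    ConjCyclic-sym
      (Linked⇒ConjCyclic-rotation-coset j i (Linked-sym (kind (i , true)) (kind (j , false)) linked))
  Linked⇒ConjCyclic (i , true)  (j , true)  linked
    with kindMod4-view nEven (toℕ i) | kindMod4-view nEven (toℕ j)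
  ... | odd i-odd _           | odd j-odd _           = ConjCyclic-odd i j i-odd j-odd
  ... | even₀ i-even _ i≡0    | even₀ j-even _ j≡0    =
    ConjCyclic-even i j i-even j-even (λ odd-n → trans (i≡0 odd-n) (sym (j≡0 odd-n)))
  ... | even₂ i-even _ _ i≡2  | even₂ j-even _ _ j≡2  =
    ConjCyclic-even i j i-even j-even (λ _ → trans i≡2 (sym j≡2))
  ... | odd _ k≡              | even₀ _ l≡ _          = ⊥-elim (subst₂ Linked k≡ l≡ linked)
  ... | odd _ k≡              | even₂ _ l≡ _ _        = ⊥-elim (subst₂ Linked k≡ l≡ linked)
  ... | even₀ _ k≡ _          | odd _ l≡              = ⊥-elim (subst₂ Linked k≡ l≡ linked)
  ... | even₂ _ k≡ _ _        | odd _ l≡              = ⊥-elim (subst₂ Linked k≡ l≡ linked)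
  ... | even₀ _ k≡ _          | even₂ _ l≡ _ _        = ⊥-elim (subst₂ Linked k≡ l≡ linked)
  ... | even₂ _ k≡ _ _        | even₀ _ l≡ _          = ⊥-elim (subst₂ Linked k≡ l≡ linked)

  CSEP-adjacencyVia : AdjacencyVia CSEP kind
  CSEP-adjacencyVia x y = mk⇔ (λ (x≢y , c) → x≢y , ConjCyclic⇒Linked x y c)
                              (λ (x≢y , l) → x≢y , Linked⇒ConjCyclic x y l)

-- Normal forms of elements

EvenIndex : ℕ → Bool → Set
EvenIndex n true = Fin (2 * n)
EvenIndex n false = Fin n ⊎ Fin n

evenExponent : ∀ n b → EvenIndex n b → ℕ
evenExponent n true w = 2 * toℕ w
evenExponent n false (inj₁ w) = 4 * toℕ w
evenExponent n false (inj₂ w) = 2 + 4 * toℕ w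

evenKind : ∀ n b → EvenIndex n b → Kind
evenKind n true _ = evenCoset₀
evenKind n false (inj₁ _) = evenCoset₀
evenKind n false (inj₂ _) = evenCoset₂

evenExponent-even : ∀ n b (x : EvenIndex n b) → ∃ λ k → evenExponent n b x ≡ 2 * k
evenExponent-even n true  w        = toℕ w , refl
evenExponent-even n false (inj₁ w) = 2 * toℕ w , 4w≡2[2w] (toℕ w)
  where
  4w≡2[2w] : ∀ w → 4 * w ≡ 2 * (2 * w)
  4w≡2[2w] = solve-∀
evenExponent-even n false (inj₂ w) = suc (2 * toℕ w) , 2+4w≡2[1+2w] (toℕ w)
  where
  2+4w≡2[1+2w] : ∀ w → 2 + 4 * w ≡ 2 * suc (2 * w)
  2+4w≡2[1+2w] = solve-∀

1+2a≢evenExponent : ∀ a n b (x : EvenIndex n b) → suc (2 * a) ≢ evenExponent n b x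
1+2a≢evenExponent a n b x eq with evenExponent-even n b x
... | k , x≡2k = 1+2a≢2b a k (trans eq x≡2k)

evenExponent-injective : ∀ n b (x x′ : EvenIndex n b) → evenExponent n b x ≡ evenExponent n b x′ → x ≡ x′
evenExponent-injective n true w w′ eq = toℕ-injective (*-cancelˡ-≡ (toℕ w) (toℕ w′) 2 eq)
evenExponent-injective n false (inj₁ w) (inj₁ w′) eq =
  cong inj₁ (toℕ-injective (*-cancelˡ-≡ (toℕ w) (toℕ w′) 4 eq))
evenExponent-injective n false (inj₂ w) (inj₂ w′) eq =
  cong inj₂ (toℕ-injective (*-cancelˡ-≡ (toℕ w) (toℕ w′) 4 (+-cancelˡ-≡ 2 _ _ eq)))
evenExponent-injective n false (inj₁ w) (inj₂ w′) eq = ⊥-elim (4a≢2+4b (toℕ w) (toℕ w′) eq)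
evenExponent-injective n false (inj₂ w) (inj₁ w′) eq = ⊥-elim (4a≢2+4b (toℕ w′) (toℕ w) (sym eq))

module Vertices (p : ℕ) (nEven : Bool) (parity : Parity nEven p) where
  open Kinds p nEven parity public

  -- The vertices of the compositions H[Γ], with the factors Fin 1 dropped.
  data Vertex : Set where
    vIdentity vCentral : Vertex
    vRotation : Fin M → Fin 2 → Vertex
    vOdd      : Fin (2 * n) → Vertex
    vEven     : EvenIndex n nEven → Vertex

  vertexKind : Vertex → Kind
  vertexKind vIdentity       = identity
  vertexKind vCentral        = central
  vertexKind (vRotation _ _) = rotation
  vertexKind (vOdd _)        = oddCoset
  vertexKind (vEven x)       = evenKind n nEven x

  rotationExponent : Fin M → Fin 2 → ℕ
  rotationExponent r w = suc (toℕ r + 2 * n * toℕ w)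

  data RotationView (j : ℕ) : Set where
    at0        : j ≡ 0 → RotationView j
    at2n       : j ≡ 2 * n → RotationView j
    atRotation : (r : Fin M) (w : Fin 2) → j ≡ rotationExponent r w → RotationView j

  fromRotationView : ∀ {j} → RotationView j → Vertex
  fromRotationView (at0 _)            = vIdentity
  fromRotationView (at2n _)           = vCentral
  fromRotationView (atRotation r w _) = vRotation r w

  data CosetView (j : ℕ) : Set where
    atOdd  : (w : Fin (2 * n)) → j ≡ suc (2 * toℕ w) → CosetView j
    atEven : (x : EvenIndex n nEven) → j ≡ evenExponent n nEven x → CosetView j

  fromCosetView : ∀ {j} → CosetView j → Vertex
  fromCosetView (atOdd w _)  = vOdd w
  fromCosetView (atEven x _) = vEven x

  rotationExponent<N : ∀ r w → rotationExponent r w < N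
  rotationExponent<N r w =
    subst (suc (rotationExponent r w) ≤_) (expand p) (s≤s (s≤s (+-mono-≤ r≤2p (*-monoʳ-≤ (2 * n) w≤1))))
    where
    r≤2p : toℕ r ≤ 2 * p
    r≤2p = ≤-pred (subst (suc (toℕ r) ≤_) M≡1+2p (toℕ<n r))
    w≤1 : toℕ w ≤ 1
    w≤1 = ≤-pred (toℕ<n w)
    expand : ∀ p → suc (suc (2 * p + 2 * suc p * 1)) ≡ 4 * suc p
    expand = solve-∀

  oddExponent<N : ∀ (w : Fin (2 * n)) → suc (2 * toℕ w) < N
  oddExponent<N w = subst₂ _≤_ (2[1+w] (toℕ w)) (2*2n≡N p) (*-monoʳ-≤ 2 (toℕ<n w))
    where
    2[1+w] : ∀ w → 2 * suc w ≡ suc (suc (2 * w))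
    2[1+w] = solve-∀
    2*2n≡N : ∀ p → 2 * (2 * suc p) ≡ 4 * suc p
    2*2n≡N = solve-∀

  4+4w≤N : ∀ (w : Fin n) → 4 + 4 * toℕ w ≤ N
  4+4w≤N w = subst (_≤ N) (4[1+w] (toℕ w)) (*-monoʳ-≤ 4 (toℕ<n w))
    where
    4[1+w] : ∀ w → 4 * suc w ≡ 4 + 4 * w
    4[1+w] = solve-∀

  evenExponent<N : ∀ b (x : EvenIndex n b) → evenExponent n b x < N
  evenExponent<N true  w        = <-trans (n<1+n _) (oddExponent<N w)
  evenExponent<N false (inj₁ w) = ≤-trans (s≤s (m≤n+m (4 * toℕ w) 3)) (4+4w≤N w)
  evenExponent<N false (inj₂ w) = ≤-trans (s≤s (s≤s (s≤s (m≤n+m (4 * toℕ w) 1)))) (4+4w≤N w)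

  rotationView : ∀ j → j < N → RotationView j
  rotationView zero    _     = at0 refl
  rotationView (suc j) 1+j<N with suc j ≟ 2 * n | j <? M
  ... | yes 1+j≡2n | _       = at2n 1+j≡2n
  ... | no _       | yes j<M =
    atRotation (fromℕ< j<M) fz
      (cong suc (sym (trans (cong₂ _+_ (toℕ-fromℕ< j<M) (*-zeroʳ (2 * n))) (+-identityʳ j))))
  ... | no 1+j≢2n  | no j≮M  =
    atRotation (fromℕ< j∸2n<M) (fs fz)
      (cong suc (sym (trans (cong₂ _+_ (toℕ-fromℕ< j∸2n<M) (*-identityʳ (2 * n))) (m∸n+n≡m 2n≤j))))
    where
    2n≤j : 2 * n ≤ j
    2n≤j = ≤∧≢⇒< (≮⇒≥ j≮M) (λ M≡j → 1+j≢2n (cong suc (sym M≡j)))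
    j<2n+M : j < 2 * n + M
    j<2n+M = ≤-pred (subst (suc (suc j) ≤_) (trans N≡2n+2n (+-suc (2 * n) M)) 1+j<N)
    j∸2n<M : j ∸ 2 * n < M
    j∸2n<M = subst (j ∸ 2 * n <_) (m+n∸m≡n (2 * n) M) (∸-monoˡ-< j<2n+M 2n≤j)

  j<N⇒j/2<2n : ∀ {j} → j < N → j / 2 < 2 * n
  j<N⇒j/2<2n {j} j<N = m<n*o⇒m/o<n {j} {2 * n} {2} (subst (j <_) N≡2n*2 j<N)

  j<N⇒j/4<n : ∀ {j} → j < N → j / 4 < n
  j<N⇒j/4<n {j} j<N = m<n*o⇒m/o<n {j} {n} {4} (subst (j <_) (*-comm 4 n) j<N)

  evenView : ∀ b j → j % 2 ≡ 0 → j < N → Σ (EvenIndex n b) (λ x → j ≡ evenExponent n b x)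
  evenView true j j-even j<N = fromℕ< (j<N⇒j/2<2n j<N) , (begin
    j                       ≡⟨ m≡m%n+[m/n]*n j 2 ⟩
    j % 2 + (j / 2) * 2     ≡⟨ cong (_+ (j / 2) * 2) j-even ⟩
    (j / 2) * 2             ≡⟨ *-comm (j / 2) 2 ⟩
    2 * (j / 2)             ≡⟨ cong (2 *_) (toℕ-fromℕ< (j<N⇒j/2<2n j<N)) ⟨
    2 * toℕ (fromℕ< (j<N⇒j/2<2n j<N)) ∎)
    where open ≡-Reasoning
  evenView false j j-even j<N with j % 4 in j%4≡ | m%n<n j 4
  ... | 0 | _ = inj₁ (fromℕ< (j<N⇒j/4<n j<N)) , (begin
    j                       ≡⟨ m≡m%n+[m/n]*n j 4 ⟩
    j % 4 + (j / 4) * 4     ≡⟨ cong (_+ (j / 4) * 4) j%4≡ ⟩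
    (j / 4) * 4             ≡⟨ *-comm (j / 4) 4 ⟩
    4 * (j / 4)             ≡⟨ cong (4 *_) (toℕ-fromℕ< (j<N⇒j/4<n j<N)) ⟨
    4 * toℕ (fromℕ< (j<N⇒j/4<n j<N)) ∎)
    where open ≡-Reasoning
  ... | 2 | _ = inj₂ (fromℕ< (j<N⇒j/4<n j<N)) , (begin
    j                       ≡⟨ m≡m%n+[m/n]*n j 4 ⟩
    j % 4 + (j / 4) * 4     ≡⟨ cong (_+ (j / 4) * 4) j%4≡ ⟩
    2 + (j / 4) * 4         ≡⟨ cong (2 +_) (*-comm (j / 4) 4) ⟩
    2 + 4 * (j / 4)         ≡⟨ cong (λ k → 2 + 4 * k) (toℕ-fromℕ< (j<N⇒j/4<n j<N)) ⟨
    2 + 4 * toℕ (fromℕ< (j<N⇒j/4<n j<N)) ∎)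
    where open ≡-Reasoning
  ... | 1 | _ with trans (sym (cong (_% 2) j%4≡)) (trans (m%4%2≡m%2 j) j-even)
  ...   | ()
  evenView false j j-even j<N | 3 | _ with trans (sym (cong (_% 2) j%4≡)) (trans (m%4%2≡m%2 j) j-even)
  ...   | ()
  evenView false j j-even j<N | suc (suc (suc (suc _))) | s≤s (s≤s (s≤s (s≤s ())))

  cosetView : ∀ j → j < N → CosetView j
  cosetView j j<N with %2≡0⊎%2≡1 j
  ... | inj₁ j-even = atEven (proj₁ (evenView nEven j j-even j<N)) (proj₂ (evenView nEven j j-even j<N))
  ... | inj₂ j-odd  = atOdd (fromℕ< (j<N⇒j/2<2n j<N)) (begin
    j                       ≡⟨ m≡m%n+[m/n]*n j 2 ⟩
    j % 2 + (j / 2) * 2     ≡⟨ cong (_+ (j / 2) * 2) j-odd ⟩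
    suc ((j / 2) * 2)       ≡⟨ cong suc (*-comm (j / 2) 2) ⟩
    suc (2 * (j / 2))       ≡⟨ cong (λ k → suc (2 * k)) (toℕ-fromℕ< (j<N⇒j/2<2n j<N)) ⟨
    suc (2 * toℕ (fromℕ< (j<N⇒j/2<2n j<N))) ∎)
    where open ≡-Reasoning

  2n≢rotationExponent : ∀ r w → 2 * n ≢ rotationExponent r w
  2n≢rotationExponent r fz eq = <-irrefl (sym M≡r) (toℕ<n r)
    where
    M≡r : M ≡ toℕ r
    M≡r = trans (suc-injective eq) (trans (cong (toℕ r +_) (*-zeroʳ (2 * n))) (+-identityʳ (toℕ r)))
  2n≢rotationExponent r (fs fz) eq =
    m≢1+n+m (2 * n) (trans eq (cong (λ x → suc (toℕ r + x)) (*-identityʳ (2 * n))))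

  r+0≢r′+2n : ∀ (r r′ : Fin M) → toℕ r + 2 * n * 0 ≢ toℕ r′ + 2 * n * 1
  r+0≢r′+2n r r′ eq = <-irrefl r≡r′+2n (begin-strict
    toℕ r               <⟨ toℕ<n r ⟩
    M                   <⟨ n<1+n M ⟩
    2 * n               ≤⟨ m≤n+m (2 * n) (toℕ r′) ⟩
    toℕ r′ + 2 * n      ≡⟨ cong (toℕ r′ +_) (*-identityʳ (2 * n)) ⟨
    toℕ r′ + 2 * n * 1  ∎)
    where
    open ≤-Reasoning
    r≡r′+2n : toℕ r ≡ toℕ r′ + 2 * n * 1
    r≡r′+2n = trans (sym (trans (cong (toℕ r +_) (*-zeroʳ (2 * n))) (+-identityʳ (toℕ r)))) eq

  vRotation-injective : ∀ r r′ w w′ → toℕ r + 2 * n * toℕ w ≡ toℕ r′ + 2 * n * toℕ w′ →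
    vRotation r w ≡ vRotation r′ w′
  vRotation-injective r r′ fz fz eq =
    cong (λ x → vRotation x fz) (toℕ-injective (+-cancelʳ-≡ (2 * n * 0) (toℕ r) (toℕ r′) eq))
  vRotation-injective r r′ (fs fz) (fs fz) eq =
    cong (λ x → vRotation x (fs fz)) (toℕ-injective (+-cancelʳ-≡ (2 * n * 1) (toℕ r) (toℕ r′) eq))
  vRotation-injective r r′ fz (fs fz) eq = ⊥-elim (r+0≢r′+2n r r′ eq)
  vRotation-injective r r′ (fs fz) fz eq = ⊥-elim (r+0≢r′+2n r′ r (sym eq))

  fromRotationView-unique : ∀ {j} (v v′ : RotationView j) → fromRotationView v ≡ fromRotationView v′
  fromRotationView-unique (at0 _)  (at0 _)  = refl
  fromRotationView-unique (at2n _) (at2n _) = refl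
  fromRotationView-unique (at0 j≡0) (at2n j≡2n) with trans (sym j≡0) j≡2n
  ... | ()
  fromRotationView-unique (at2n j≡2n) (at0 j≡0) with trans (sym j≡0) j≡2n
  ... | ()
  fromRotationView-unique (at0 j≡0) (atRotation _ _ j≡) with trans (sym j≡0) j≡
  ... | ()
  fromRotationView-unique (atRotation _ _ j≡) (at0 j≡0) with trans (sym j≡0) j≡
  ... | ()
  fromRotationView-unique (at2n j≡2n) (atRotation r w j≡) = ⊥-elim (2n≢rotationExponent r w (trans (sym j≡2n) j≡))
  fromRotationView-unique (atRotation r w j≡) (at2n j≡2n) = ⊥-elim (2n≢rotationExponent r w (trans (sym j≡2n) j≡))
  fromRotationView-unique (atRotation r w j≡) (atRotation r′ w′ j≡′) =
    vRotation-injective r r′ w w′ (suc-injective (trans (sym j≡) j≡′))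

  fromCosetView-unique : ∀ {j} (v v′ : CosetView j) → fromCosetView v ≡ fromCosetView v′
  fromCosetView-unique (atOdd w j≡) (atOdd w′ j≡′) =
    cong vOdd (toℕ-injective (*-cancelˡ-≡ (toℕ w) (toℕ w′) 2 (suc-injective (trans (sym j≡) j≡′))))
  fromCosetView-unique (atEven x j≡) (atEven x′ j≡′) =
    cong vEven (evenExponent-injective n nEven x x′ (trans (sym j≡) j≡′))
  fromCosetView-unique (atOdd w j≡) (atEven x j≡′) =
    ⊥-elim (1+2a≢evenExponent (toℕ w) n nEven x (trans (sym j≡) j≡′))
  fromCosetView-unique (atEven x j≡′) (atOdd w j≡) =
    ⊥-elim (1+2a≢evenExponent (toℕ w) n nEven x (trans (sym j≡) j≡′))

  toVertex : El → Vertex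
  toVertex (i , false) = fromRotationView (rotationView (toℕ i) (toℕ<n i))
  toVertex (i , true)  = fromCosetView (cosetView (toℕ i) (toℕ<n i))

  fromVertex : Vertex → El
  fromVertex vIdentity       = fromℕ< {0} (s≤s z≤n) , false
  fromVertex vCentral        = fromℕ< 2n<N , false
  fromVertex (vRotation r w) = fromℕ< (rotationExponent<N r w) , false
  fromVertex (vOdd w)        = fromℕ< (oddExponent<N w) , true
  fromVertex (vEven x)       = fromℕ< (evenExponent<N nEven x) , true

  fromVertex-fromRotationView : ∀ {j} (v : RotationView j) (i : Fin N) → toℕ i ≡ j →
    fromVertex (fromRotationView v) ≡ (i , false)
  fromVertex-fromRotationView (at0 j≡0) i i≡j = El-ext (sym (trans i≡j j≡0)) refl
  fromVertex-fromRotationView (at2n j≡2n) i i≡j =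
    El-ext (trans (toℕ-fromℕ< 2n<N) (sym (trans i≡j j≡2n))) refl
  fromVertex-fromRotationView (atRotation r w j≡) i i≡j =
    El-ext (trans (toℕ-fromℕ< (rotationExponent<N r w)) (sym (trans i≡j j≡))) refl

  fromVertex-fromCosetView : ∀ {j} (v : CosetView j) (i : Fin N) → toℕ i ≡ j →
    fromVertex (fromCosetView v) ≡ (i , true)
  fromVertex-fromCosetView (atOdd w j≡) i i≡j =
    El-ext (trans (toℕ-fromℕ< (oddExponent<N w)) (sym (trans i≡j j≡))) refl
  fromVertex-fromCosetView (atEven x j≡) i i≡j =
    El-ext (trans (toℕ-fromℕ< (evenExponent<N nEven x)) (sym (trans i≡j j≡))) refl

  fromVertex-toVertex : ∀ x → fromVertex (toVertex x) ≡ x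
  fromVertex-toVertex (i , false) = fromVertex-fromRotationView (rotationView (toℕ i) (toℕ<n i)) i refl
  fromVertex-toVertex (i , true)  = fromVertex-fromCosetView (cosetView (toℕ i) (toℕ<n i)) i refl

  toVertex-fromVertex : ∀ t → toVertex (fromVertex t) ≡ t
  toVertex-fromVertex vIdentity =
    fromRotationView-unique (rotationView _ (toℕ<n _)) (at0 refl)
  toVertex-fromVertex vCentral =
    fromRotationView-unique (rotationView _ (toℕ<n _)) (at2n (toℕ-fromℕ< 2n<N))
  toVertex-fromVertex (vRotation r w) =
    fromRotationView-unique (rotationView _ (toℕ<n _)) (atRotation r w (toℕ-fromℕ< (rotationExponent<N r w)))
  toVertex-fromVertex (vOdd w) =
    fromCosetView-unique (cosetView _ (toℕ<n _)) (atOdd w (toℕ-fromℕ< (oddExponent<N w)))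
  toVertex-fromVertex (vEven x) =
    fromCosetView-unique (cosetView _ (toℕ<n _)) (atEven x (toℕ-fromℕ< (evenExponent<N nEven x)))

  El↔Vertex : El ↔ Vertex
  El↔Vertex = mk↔ₛ′ toVertex fromVertex toVertex-fromVertex fromVertex-toVertex

  kind-rotationView : ∀ {j} (v : RotationView j) → rotationKind j ≡ vertexKind (fromRotationView v)
  kind-rotationView (at0 j≡0)   = cong rotationKind j≡0
  kind-rotationView (at2n j≡2n) = trans (cong rotationKind j≡2n) rotationKind-2n
  kind-rotationView {j} (atRotation r w j≡) with rotationKindBy-cases (j ≟ 0) (j ≟ 2 * n)
  ... | inj₁ (j≡0 , _) with fromRotationView-unique (at0 j≡0) (atRotation r w j≡)
  ...   | ()
  kind-rotationView {j} (atRotation r w j≡) | inj₂ (inj₁ (j≡2n , _))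
    with fromRotationView-unique (at2n j≡2n) (atRotation r w j≡)
  ...   | ()
  kind-rotationView {j} (atRotation r w j≡) | inj₂ (inj₂ k≡rotation) = k≡rotation

  kind-evenExponent : ∀ b (x : EvenIndex n b) {j} → j ≡ evenExponent n b x → kindMod4 b (j % 4) ≡ evenKind n b x
  kind-evenExponent true w {j} j≡ =
    kindMod4-true-even (m%n<n j 4) (trans (m%4%2≡m%2 j) (trans (cong (_% 2) j≡) ([2b]%2≡0 (toℕ w))))
  kind-evenExponent false (inj₁ w) j≡ = cong (kindMod4 false) (trans (cong (_% 4) j≡) ([4a]%4≡0 (toℕ w)))
  kind-evenExponent false (inj₂ w) j≡ = cong (kindMod4 false) (trans (cong (_% 4) j≡) ([2+4a]%4≡2 (toℕ w)))

  kind-cosetView : ∀ {j} (v : CosetView j) → cosetKind j ≡ vertexKind (fromCosetView v)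
  kind-cosetView {j} (atOdd w j≡) =
    kindMod4-odd nEven (m%n<n j 4) (trans (m%4%2≡m%2 j) (trans (cong (_% 2) j≡) ([1+2a]%2≡1 (toℕ w))))
  kind-cosetView (atEven x j≡) = kind-evenExponent nEven x j≡

  kind≡vertexKind : ∀ x → kind x ≡ vertexKind (toVertex x)
  kind≡vertexKind (i , false) = kind-rotationView (rotationView (toℕ i) (toℕ<n i))
  kind≡vertexKind (i , true)  = kind-cosetView (cosetView (toℕ i) (toℕ<n i))

centreKind : ∀ {m} → V (K 1 ∨ᴳ (K m ∪ᴳ K 1)) → Kind
centreKind = [ (λ _ → central) , [ (λ _ → rotation) , (λ _ → oddCoset) ] ]

centre-adjacencyVia : ∀ m → AdjacencyVia (K 1 ∨ᴳ (K m ∪ᴳ K 1)) centreKind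
centre-adjacencyVia m = ∨-adjacencyVia (K-adjacencyVia central tt)
  (∪-adjacencyVia (K-adjacencyVia rotation tt) (K-adjacencyVia oddCoset tt) (λ _ _ ()) (λ _ _ ()))
  central-linked (λ x y → Linked-sym central (sides y) (central-linked x y))
  where
  sides : Fin m ⊎ Fin 1 → Kind
  sides = [ (λ _ → rotation) , (λ _ → oddCoset) ]
  central-linked : ∀ (x : Fin 1) y → Linked central (sides y)
  central-linked _ (inj₁ _) = tt
  central-linked _ (inj₂ _) = tt

K1∨-adjacencyVia : ∀ {Δ d} → AdjacencyVia Δ d → AdjacencyVia (K 1 ∨ᴳ Δ) [ (λ _ → identity) , d ]
K1∨-adjacencyVia {d = d} Δd =
  ∨-adjacencyVia (K-adjacencyVia identity tt) Δd (λ _ _ → tt) (λ _ y → Linked-identityʳ (d y))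

Heven-kind : ∀ n → V (Heven n) → Kind
Heven-kind n = [ (λ _ → identity) , [ centreKind , (λ _ → evenCoset₀) ] ]

Heven-adjacencyVia : ∀ n → AdjacencyVia (Heven n) (Heven-kind n)
Heven-adjacencyVia n = K1∨-adjacencyVia
  (∪-adjacencyVia (centre-adjacencyVia (2 * n ∸ 1)) (K-adjacencyVia evenCoset₀ tt) unlinked
                  (λ x y → unlinked x y ∘ Linked-sym evenCoset₀ (centreKind x)))
  where
  unlinked : ∀ x (y : Fin 1) → ¬ Linked (centreKind x) evenCoset₀
  unlinked (inj₁ _)        _ ()
  unlinked (inj₂ (inj₁ _)) _ ()
  unlinked (inj₂ (inj₂ _)) _ ()

Hodd-kind : ∀ n → V (Hodd n) → Kind
Hodd-kind n = [ (λ _ → identity) , [ centreKind , [ (λ _ → evenCoset₀) , (λ _ → evenCoset₂) ] ] ]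

Hodd-adjacencyVia : ∀ n → AdjacencyVia (Hodd n) (Hodd-kind n)
Hodd-adjacencyVia n = K1∨-adjacencyVia
  (∪-adjacencyVia (centre-adjacencyVia (2 * n ∸ 1))
     (∪-adjacencyVia (K-adjacencyVia evenCoset₀ tt) (K-adjacencyVia evenCoset₂ tt) (λ _ _ ()) (λ _ _ ()))
     unlinked (λ x y → unlinked x y ∘ Linked-sym (evenKinds y) (centreKind x)))
  where
  evenKinds : Fin 1 ⊎ Fin 1 → Kind
  evenKinds = [ (λ _ → evenCoset₀) , (λ _ → evenCoset₂) ]
  unlinked : ∀ x y → ¬ Linked (centreKind x) (evenKinds y)
  unlinked (inj₁ _)        (inj₁ _) ()
  unlinked (inj₂ (inj₁ _)) (inj₁ _) ()
  unlinked (inj₂ (inj₂ _)) (inj₁ _) ()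
  unlinked (inj₁ _)        (inj₂ _) ()
  unlinked (inj₂ (inj₁ _)) (inj₂ _) ()
  unlinked (inj₂ (inj₂ _)) (inj₂ _) ()

-- The vertices of H numbered as in the statement: 1, 2, 3..2n+1, 2n+2, and 2n+3 (2n+3, 2n+4 for odd n).
pattern hIdentity   = inj₁ fz
pattern hCentral    = inj₂ (inj₁ (inj₁ fz))
pattern hRotation r = inj₂ (inj₁ (inj₂ (inj₁ r)))
pattern hOdd        = inj₂ (inj₁ (inj₂ (inj₂ fz)))
pattern hEven       = inj₂ (inj₂ fz)
pattern hEven₀      = inj₂ (inj₂ (inj₁ fz))
pattern hEven₂      = inj₂ (inj₂ (inj₂ fz))

Γeven-complete : ∀ n i u v → Adj (Γeven n i) u v ⇔ (u ≢ v)
Γeven-complete n (inj₁ _)                      _ _ = mk⇔ id id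
Γeven-complete n (inj₂ (inj₁ (inj₁ _)))        _ _ = mk⇔ id id
Γeven-complete n (inj₂ (inj₁ (inj₂ (inj₁ _)))) _ _ = mk⇔ id id
Γeven-complete n (inj₂ (inj₁ (inj₂ (inj₂ _)))) _ _ = mk⇔ id id
Γeven-complete n (inj₂ (inj₂ _))               _ _ = mk⇔ id id

Γodd-complete : ∀ n i u v → Adj (Γodd n i) u v ⇔ (u ≢ v)
Γodd-complete n (inj₁ _)                      _ _ = mk⇔ id id
Γodd-complete n (inj₂ (inj₁ (inj₁ _)))        _ _ = mk⇔ id id
Γodd-complete n (inj₂ (inj₁ (inj₂ (inj₁ _)))) _ _ = mk⇔ id id
Γodd-complete n (inj₂ (inj₁ (inj₂ (inj₂ _)))) _ _ = mk⇔ id id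
Γodd-complete n (inj₂ (inj₂ (inj₁ _)))        _ _ = mk⇔ id id
Γodd-complete n (inj₂ (inj₂ (inj₂ _)))        _ _ = mk⇔ id id

Heven-≟ : ∀ n → DecidableEquality (V (Heven n))
Heven-≟ n = ≡-dec _≟ᶠ_ (≡-dec (≡-dec _≟ᶠ_ (≡-dec _≟ᶠ_ _≟ᶠ_)) _≟ᶠ_)

Hodd-≟ : ∀ n → DecidableEquality (V (Hodd n))
Hodd-≟ n = ≡-dec _≟ᶠ_ (≡-dec (≡-dec _≟ᶠ_ (≡-dec _≟ᶠ_ _≟ᶠ_)) (≡-dec _≟ᶠ_ _≟ᶠ_))

module EvenCase (r : ℕ) where
  open Vertices (suc (2 * r)) true (r , refl)

  toComposition : Vertex → V (composition (Heven n) (Γeven n))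
  toComposition vIdentity       = hIdentity , fz
  toComposition vCentral        = hCentral , fz
  toComposition (vRotation r w) = hRotation r , w
  toComposition (vOdd w)        = hOdd , w
  toComposition (vEven w)       = hEven , w

  fromComposition : V (composition (Heven n) (Γeven n)) → Vertex
  fromComposition (hIdentity , fz)  = vIdentity
  fromComposition (hCentral , fz)   = vCentral
  fromComposition (hRotation r , w) = vRotation r w
  fromComposition (hOdd , w)        = vOdd w
  fromComposition (hEven , w)       = vEven w

  Vertex↔composition : Vertex ↔ V (composition (Heven n) (Γeven n))
  Vertex↔composition = mk↔ₛ′ toComposition fromComposition to∘from from∘to
    where
    to∘from : ∀ v → toComposition (fromComposition v) ≡ v
    to∘from (hIdentity , fz)  = refl
    to∘from (hCentral , fz)   = refl
    to∘from (hRotation r , w) = refl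
    to∘from (hOdd , w)        = refl
    to∘from (hEven , w)       = refl
    from∘to : ∀ t → fromComposition (toComposition t) ≡ t
    from∘to vIdentity       = refl
    from∘to vCentral        = refl
    from∘to (vRotation r w) = refl
    from∘to (vOdd w)        = refl
    from∘to (vEven w)       = refl

  kind-toComposition : ∀ t → Heven-kind n (proj₁ (toComposition t)) ≡ vertexKind t
  kind-toComposition vIdentity       = refl
  kind-toComposition vCentral        = refl
  kind-toComposition (vRotation r w) = refl
  kind-toComposition (vOdd w)        = refl
  kind-toComposition (vEven w)       = refl

  CSEP≅composition : CSEP ≅ composition (Heven n) (Γeven n)
  CSEP≅composition = ≅-via {c = kind} {d = Heven-kind n ∘ proj₁} CSEP-adjacencyVia
    (composition-adjacencyVia {c = Heven-kind n} (Heven-≟ n) Linked-refl (Γeven-complete n) (Heven-adjacencyVia n))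
    (↔-trans El↔Vertex Vertex↔composition)
    (λ x → trans (kind-toComposition (toVertex x)) (sym (kind≡vertexKind x)))

module OddCase (q : ℕ) where
  open Vertices (2 * q) false (q , refl)

  toComposition : Vertex → V (composition (Hodd n) (Γodd n))
  toComposition vIdentity        = hIdentity , fz
  toComposition vCentral         = hCentral , fz
  toComposition (vRotation r w)  = hRotation r , w
  toComposition (vOdd w)         = hOdd , w
  toComposition (vEven (inj₁ w)) = hEven₀ , w
  toComposition (vEven (inj₂ w)) = hEven₂ , w

  fromComposition : V (composition (Hodd n) (Γodd n)) → Vertex
  fromComposition (hIdentity , fz)  = vIdentity
  fromComposition (hCentral , fz)   = vCentral
  fromComposition (hRotation r , w) = vRotation r w
  fromComposition (hOdd , w)        = vOdd w
  fromComposition (hEven₀ , w)      = vEven (inj₁ w)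
  fromComposition (hEven₂ , w)      = vEven (inj₂ w)

  Vertex↔composition : Vertex ↔ V (composition (Hodd n) (Γodd n))
  Vertex↔composition = mk↔ₛ′ toComposition fromComposition to∘from from∘to
    where
    to∘from : ∀ v → toComposition (fromComposition v) ≡ v
    to∘from (hIdentity , fz)  = refl
    to∘from (hCentral , fz)   = refl
    to∘from (hRotation r , w) = refl
    to∘from (hOdd , w)        = refl
    to∘from (hEven₀ , w)      = refl
    to∘from (hEven₂ , w)      = refl
    from∘to : ∀ t → fromComposition (toComposition t) ≡ t
    from∘to vIdentity        = refl
    from∘to vCentral         = refl
    from∘to (vRotation r w)  = refl
    from∘to (vOdd w)         = refl
    from∘to (vEven (inj₁ w)) = refl
    from∘to (vEven (inj₂ w)) = refl

  kind-toComposition : ∀ t → Hodd-kind n (proj₁ (toComposition t)) ≡ vertexKind t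
  kind-toComposition vIdentity        = refl
  kind-toComposition vCentral         = refl
  kind-toComposition (vRotation r w)  = refl
  kind-toComposition (vOdd w)         = refl
  kind-toComposition (vEven (inj₁ w)) = refl
  kind-toComposition (vEven (inj₂ w)) = refl

  CSEP≅composition : CSEP ≅ composition (Hodd n) (Γodd n)
  CSEP≅composition = ≅-via {c = kind} {d = Hodd-kind n ∘ proj₁} CSEP-adjacencyVia
    (composition-adjacencyVia {c = Hodd-kind n} (Hodd-≟ n) Linked-refl (Γodd-complete n) (Hodd-adjacencyVia n))
    (↔-trans El↔Vertex Vertex↔composition)
    (λ x → trans (kind-toComposition (toVertex x)) (sym (kind≡vertexKind x)))

even⇒≡2+2r : ∀ {n} → 2 ≤ n → Even n → ∃ λ r → n ≡ 2 + 2 * r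
even⇒≡2+2r (s≤s (s≤s _)) (divides (suc r) n≡[1+r]*2) = r , trans n≡[1+r]*2 (regroup r)
  where
  regroup : ∀ r → suc r * 2 ≡ 2 + 2 * r
  regroup = solve-∀

odd⇒≡1+2q : ∀ {n} → Odd n → ∃ λ q → n ≡ 1 + 2 * q
odd⇒≡1+2q {n} n-odd with %2≡0⊎%2≡1 n
... | inj₁ n%2≡0 = ⊥-elim (n-odd (m%n≡0⇒n∣m n 2 n%2≡0))
... | inj₂ n%2≡1 = n / 2 , trans (m≡m%n+[m/n]*n n 2) (trans (cong (_+ (n / 2) * 2) n%2≡1) (regroup (n / 2)))
  where
  regroup : ∀ q → 1 + q * 2 ≡ 1 + 2 * q
  regroup = solve-∀

mainTheorem12 : (n : ℕ) .{{_ : NonZero n}} → 2 ≤ n →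
    ((Even n → SD.CSEP n ≅ composition (Heven n) (Γeven n))
     × (Odd n → SD.CSEP n ≅ composition (Hodd n) (Γodd n)))
mainTheorem12 n 2≤n = even-case , odd-case
  where
  even-case : Even n → SD.CSEP n ≅ composition (Heven n) (Γeven n)
  even-case n-even with even⇒≡2+2r 2≤n n-even
  ... | r , refl = EvenCase.CSEP≅composition r
  odd-case : Odd n → SD.CSEP n ≅ composition (Hodd n) (Γodd n)
  odd-case n-odd with odd⇒≡1+2q n-odd
  ... | q , refl = OddCase.CSEP≅composition q
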